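{- Let $n\ge 3$ be odd and let $D_{2n}=\langle a,b : a^n=b^2=e,\ ba=a^{ -1}b\rangle$. Then the characteristic polynomial of the Laplacian matrix of $CSEP(D_{2n})$ is \[\Phi(L(CSEP(D_{2n})),x)=x(x-1)(x-(n+1))^{n-1}(x-2n)(x-n)^{n-2}.\]
   Context: For a finite group $G$ and $x\in G$, $[x]$ denotes the conjugacy class of $x$. The conjugacy superenhanced power graph $CSEP(G)$ is the simple graph with vertex set $G$ in which two distinct vertices $x,y$ are adjacent iff there exist $x'\in[x]$, $y'\in[y]$ lying in a common cyclic subgroup of $G$ ($x'=y'$ permitted, so distinct conjugate elements are always adjacent). The Laplacian matrix of a graph is $L=D-A$ where $D$ is the diagonal degree matrix and $A$ the adjacency matrix; $\Phi(L,x)=\det(xI-L)$. -}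

module Defs where

open import Level using (Level)
open import Data.Nat as ℕ using (ℕ; zero; suc)
open import Data.Nat.DivMod using (_%_; m%n<n)
open import Data.Fin as Fin using (Fin; zero; suc; toℕ; fromℕ<; splitAt; punchIn)
open import Data.Bool using (Bool; true; false; if_then_else_; _xor_)
open import Data.Product using (_×_; _,_; ∃; ∃-syntax)
open import Data.Sum using (inj₁; inj₂)
open import Relation.Binary.PropositionalEquality using (_≡_; _≢_)
open import Relation.Nullary using (Dec; does)
open import Algebra.Bundles using (CommutativeRing)

addMod : ∀ {n} → Fin n → Fin n → Fin n
addMod {suc k} i j = fromℕ< (m%n<n (toℕ i ℕ.+ toℕ j) (suc k))

negMod : ∀ {n} → Fin n → Fin n
negMod {suc k} i = fromℕ< (m%n<n ((suc k) ℕ.∸ toℕ i) (suc k))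

-- The dihedral group D_{2n} = ⟨a, b | a^n = b^2 = e, ba = a⁻¹b⟩ of order 2n.
-- The element (i , false) is a^i and (i , true) is a^i b.

D : ℕ → Set
D n = Fin n × Bool

-- a^i b^s · a^k b^t = a^(i + (-1)^s k) b^(s+t)
mul : ∀ {n} → D n → D n → D n
mul (i , s) (k , t) = addMod i (if s then negMod k else k) , s xor t

inv : ∀ {n} → D n → D n
inv (i , false) = negMod i , false
inv (i , true)  = i , true

-- positive powers: pow⁺ z p = z^(p+1)  (every power of z, including e = z^(ord z), is of this form)
pow⁺ : ∀ {n} → D n → ℕ → D n
pow⁺ z zero    = z
pow⁺ z (suc p) = mul z (pow⁺ z p)

Conj : ∀ {n} → D n → D n → Set
Conj x y = ∃[ g ] mul (mul g x) (inv g) ≡ y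

InCommonCyclic : ∀ {n} → D n → D n → Set
InCommonCyclic x y = ∃[ z ] ∃[ p ] ∃[ q ] (x ≡ pow⁺ z p × y ≡ pow⁺ z q)

CSEPAdj : ∀ {n} → D n → D n → Set
CSEPAdj x y = x ≢ y × ∃[ x' ] ∃[ y' ] (Conj x x' × Conj y y' × InCommonCyclic x' y')

-- enumeration of the 2n vertices: index k ↦ a^k (k < n), n + k ↦ a^k b
vertex : ∀ n → Fin (n ℕ.+ n) → D n
vertex n k with splitAt n k
... | inj₁ i = i , false
... | inj₂ i = i , true

module Matrices {c ℓ : Level} (R : CommutativeRing c ℓ) where
  open CommutativeRing R using (Carrier; _+_; _*_; -_; _-_; 0#; 1#)

  sumF : ∀ {m} → (Fin m → Carrier) → Carrier
  sumF {zero}  f = 0#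
  sumF {suc m} f = f zero + sumF (λ j → f (suc j))

  sgn : ℕ → Carrier
  sgn zero    = 1#
  sgn (suc k) = - sgn k

  _^_ : Carrier → ℕ → Carrier
  x ^ zero  = 1#
  x ^ suc k = x * (x ^ k)

  natR : ℕ → Carrier
  natR zero    = 0#
  natR (suc k) = 1# + natR k

  det : ∀ {m} → (Fin m → Fin m → Carrier) → Carrier
  det {zero}  M = 1#
  det {suc m} M = sumF λ j → sgn (toℕ j) * (M zero j * det (λ r s → M (suc r) (punchIn j s)))

  idM : ∀ {m} → Fin m → Fin m → Carrier
  idM i j = if does (i Fin.≟ j) then 1# else 0#

  adjMatrix : ∀ {m} {V : Set} (vert : Fin m → V) (Adj : V → V → Set) →
              (∀ u v → Dec (Adj u v)) → Fin m → Fin m → Carrier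
  adjMatrix vert Adj adj? i j = if does (adj? (vert i) (vert j)) then 1# else 0#

  laplacian : ∀ {m} → (Fin m → Fin m → Carrier) → Fin m → Fin m → Carrier
  laplacian A i j = (idM i j * sumF (A i)) - A i j

  charPolyAt : ∀ {m} → (Fin m → Fin m → Carrier) → Carrier → Carrier
  charPolyAt L x = det (λ i j → (x * idM i j) - L i j)

module Submission where

-- For n odd, CSEP(D₂ₙ) is K₁ ∨ (K_{n-1} ⊔ K_n): the identity is joined to everything, the
-- rotations all lie in ⟨a⟩, the reflections are all conjugate, and no nontrivial rotation
-- shares a cyclic subgroup with a reflection.  For the Laplacian L of K₁ ∨ (K_p ⊔ K_q) every
-- column of xI - L sums to x, so adding all rows to row 0 factors out x; subtracting the
-- resulting row of ones from the others clears column 0 and leaves [[aI, -J], [-J, dI]] with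
-- a = x - p - 1 and d = x - q - 1, whose determinant a^(p-1) d^(q-1) (ad - pq) factors as
-- a^(p-1) d^(q-1) (x - 1) (x - p - q - 1).

open import Defs
open import Level using (Level)
open import Data.Nat using (ℕ; _≤_; _∸_)
open import Data.Nat.DivMod using (_%_)
open import Relation.Binary.PropositionalEquality using (_≡_)
open import Relation.Nullary using (Dec)
open import Algebra.Bundles using (CommutativeRing)

open import Data.Nat as ℕ using (zero; suc)
import Data.Nat.Properties as ℕ
open import Data.Nat.DivMod
  using (_/_; m%n<n; m%n%n≡m%n; m≡m%n+[m/n]*n; %-distribˡ-+; [m+kn]%n≡m%n; [m+n]%n≡m%n; m<n⇒m%n≡m; n%n≡0)
open import Data.Nat.Solver using (module +-*-Solver)
open import Data.Integer as ℤ using (ℤ; +_; -[1+_])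
import Data.Integer.Properties as ℤ
import Data.Sign as Sign
open import Data.Fin as Fin using (Fin; zero; suc; toℕ; punchIn; punchOut)
import Data.Fin.Properties as Fin
open import Data.Bool using (Bool; true; false; if_then_else_; not)
open import Data.Maybe using (Maybe; just; nothing)
open import Data.Product using (_×_; _,_; proj₁; proj₂; ∃-syntax)
open import Data.Sum using (_⊎_; inj₁; inj₂)
import Data.Sum.Properties as Sum
open import Data.Empty using (⊥; ⊥-elim)
open import Function using (_∘_)
open import Function.Bundles using (mk⇔)
open import Relation.Nullary using (yes; no; does)
open import Relation.Nullary.Decidable using (dec-true; dec-false; does-⇔)
open import Relation.Binary.PropositionalEquality using (_≢_)
import Relation.Binary.PropositionalEquality as ≡
import Relation.Binary.Reasoning.Setoid as SetoidReasoning
open import Algebra.Bundles using (RawRing)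
import Algebra.Solver.Ring as RingSolver
open import Algebra.Solver.Ring.AlmostCommutativeRing using (fromCommutativeRing; _-Raw-AlmostCommutative⟶_)

-- The ring solver needs a coefficient ring with computable equality: ℤ, mapped into R.
module IntegerCoefficients {c ℓ : Level} (R : CommutativeRing c ℓ) where
  open CommutativeRing R
  open Matrices R using (natR)
  open import Algebra.Properties.Ring ring
    using (-‿involutive; -0#≈0#; -‿distribˡ-*; -‿distribʳ-*; -‿+-comm)
  open SetoidReasoning setoid

  natR-+ : ∀ m n → natR (m ℕ.+ n) ≈ natR m + natR n
  natR-+ zero    n = sym (+-identityˡ _)
  natR-+ (suc m) n = trans (+-congˡ (natR-+ m n)) (sym (+-assoc _ _ _))

  natR-* : ∀ m n → natR (m ℕ.* n) ≈ natR m * natR n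
  natR-* zero    n = sym (zeroˡ _)
  natR-* (suc m) n = begin
    natR (n ℕ.+ m ℕ.* n)            ≈⟨ natR-+ n (m ℕ.* n) ⟩
    natR n + natR (m ℕ.* n)         ≈⟨ +-cong (sym (*-identityˡ _)) (natR-* m n) ⟩
    1# * natR n + natR m * natR n   ≈⟨ distribʳ _ _ _ ⟨
    (1# + natR m) * natR n          ∎

  private
    -‿*-‿ : ∀ x y → - x * - y ≈ x * y
    -‿*-‿ x y = begin
      - x * - y      ≈⟨ -‿distribˡ-* x (- y) ⟨
      - (x * - y)    ≈⟨ -‿cong (-‿distribʳ-* x y) ⟨
      - - (x * y)    ≈⟨ -‿involutive _ ⟩
      x * y          ∎

    [1+x]-[1+y] : ∀ x y → (1# + x) - (1# + y) ≈ x - y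
    [1+x]-[1+y] x y = begin
      (1# + x) + - (1# + y)      ≈⟨ +-congˡ (-‿+-comm 1# y) ⟨
      (1# + x) + (- 1# + - y)    ≈⟨ +-assoc _ _ _ ⟩
      1# + (x + (- 1# + - y))    ≈⟨ +-congˡ (+-assoc _ _ _) ⟨
      1# + ((x + - 1#) + - y)    ≈⟨ +-congˡ (+-congʳ (+-comm _ _)) ⟩
      1# + ((- 1# + x) + - y)    ≈⟨ +-congˡ (+-assoc _ _ _) ⟩
      1# + (- 1# + (x + - y))    ≈⟨ +-assoc _ _ _ ⟨
      (1# + - 1#) + (x + - y)    ≈⟨ +-congʳ (-‿inverseʳ 1#) ⟩
      0# + (x - y)               ≈⟨ +-identityˡ _ ⟩
      x - y                      ∎

    ⟦_⟧ : ℤ → Carrier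
    ⟦ + n ⟧      = natR n
    ⟦ -[1+ n ] ⟧ = - natR (suc n)

    ⊖-homo : ∀ m n → ⟦ m ℤ.⊖ n ⟧ ≈ natR m - natR n
    ⊖-homo zero    zero    = sym (-‿inverseʳ 0#)
    ⊖-homo zero    (suc n) = sym (+-identityˡ _)
    ⊖-homo (suc m) zero    = sym (trans (+-congˡ -0#≈0#) (+-identityʳ _))
    ⊖-homo (suc m) (suc n) rewrite ℤ.[1+m]⊖[1+n]≡m⊖n m n =
      trans (⊖-homo m n) (sym ([1+x]-[1+y] _ _))

    +◃-homo : ∀ n → ⟦ Sign.+ ℤ.◃ n ⟧ ≈ natR n
    +◃-homo zero    = refl
    +◃-homo (suc n) = refl

    -◃-homo : ∀ n → ⟦ Sign.- ℤ.◃ n ⟧ ≈ - natR n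
    -◃-homo zero    = sym -0#≈0#
    -◃-homo (suc n) = refl

    ⟦⟧-+ : ∀ i j → ⟦ i ℤ.+ j ⟧ ≈ ⟦ i ⟧ + ⟦ j ⟧
    ⟦⟧-+ (+ m)      (+ n)      = natR-+ m n
    ⟦⟧-+ (+ m)      -[1+ n ]   = ⊖-homo m (suc n)
    ⟦⟧-+ -[1+ m ]   (+ n)      = trans (⊖-homo n (suc m)) (+-comm _ _)
    ⟦⟧-+ -[1+ m ]   -[1+ n ]   = begin
      - (1# + natR (suc (m ℕ.+ n)))     ≈⟨ -‿cong (+-congˡ (reflexive (≡.cong natR (≡.sym (ℕ.+-suc m n))))) ⟩
      - natR (suc m ℕ.+ suc n)          ≈⟨ -‿cong (natR-+ (suc m) (suc n)) ⟩
      - (natR (suc m) + natR (suc n))   ≈⟨ -‿+-comm _ _ ⟨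
      - natR (suc m) + - natR (suc n)   ∎

    ⟦⟧-* : ∀ i j → ⟦ i ℤ.* j ⟧ ≈ ⟦ i ⟧ * ⟦ j ⟧
    ⟦⟧-* (+ m)    (+ n)    = trans (+◃-homo (m ℕ.* n)) (natR-* m n)
    ⟦⟧-* (+ m)    -[1+ n ] = trans (-◃-homo (m ℕ.* suc n)) (trans (-‿cong (natR-* m (suc n))) (-‿distribʳ-* _ _))
    ⟦⟧-* -[1+ m ] (+ n)    = trans (-◃-homo (suc m ℕ.* n)) (trans (-‿cong (natR-* (suc m) n)) (-‿distribˡ-* _ _))
    ⟦⟧-* -[1+ m ] -[1+ n ] = trans (+◃-homo (suc m ℕ.* suc n)) (trans (natR-* (suc m) (suc n)) (sym (-‿*-‿ _ _)))

    ⟦⟧-neg : ∀ i → ⟦ ℤ.- i ⟧ ≈ - ⟦ i ⟧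
    ⟦⟧-neg (+ zero)  = sym -0#≈0#
    ⟦⟧-neg (+ suc n) = refl
    ⟦⟧-neg -[1+ n ]  = sym (-‿involutive _)

  -- Unlike natR, this sends 1 to 1# itself, so that solver constants
  -- agree definitionally with the constants occurring in goals.
  fromℕ : ℕ → Carrier
  fromℕ zero          = 0#
  fromℕ (suc zero)    = 1#
  fromℕ (suc (suc n)) = 1# + fromℕ (suc n)

  fromℕ≈natR : ∀ n → fromℕ n ≈ natR n
  fromℕ≈natR zero          = refl
  fromℕ≈natR (suc zero)    = sym (+-identityʳ 1#)
  fromℕ≈natR (suc (suc n)) = +-congˡ (fromℕ≈natR (suc n))

  fromℤ : ℤ → Carrier
  fromℤ (+ n)      = fromℕ n
  fromℤ -[1+ n ]   = - fromℕ (suc n)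

  private
    fromℤ≈⟦⟧ : ∀ i → fromℤ i ≈ ⟦ i ⟧
    fromℤ≈⟦⟧ (+ n)    = fromℕ≈natR n
    fromℤ≈⟦⟧ -[1+ n ] = -‿cong (fromℕ≈natR (suc n))

    ℤ-rawRing : RawRing _ _
    ℤ-rawRing = record
      { Carrier = ℤ ; _≈_ = _≡_ ; _+_ = ℤ._+_ ; _*_ = ℤ._*_ ; -_ = ℤ.-_ ; 0# = + 0 ; 1# = + 1 }

    fromℤ-morphism : ℤ-rawRing -Raw-AlmostCommutative⟶ fromCommutativeRing R
    fromℤ-morphism = record
      { ⟦_⟧    = fromℤ
      ; +-homo = λ i j → trans (fromℤ≈⟦⟧ (i ℤ.+ j)) (trans (⟦⟧-+ i j) (sym (+-cong (fromℤ≈⟦⟧ i) (fromℤ≈⟦⟧ j))))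
      ; *-homo = λ i j → trans (fromℤ≈⟦⟧ (i ℤ.* j)) (trans (⟦⟧-* i j) (sym (*-cong (fromℤ≈⟦⟧ i) (fromℤ≈⟦⟧ j))))
      ; -‿homo = λ i → trans (fromℤ≈⟦⟧ (ℤ.- i)) (trans (⟦⟧-neg i) (sym (-‿cong (fromℤ≈⟦⟧ i))))
      ; 0-homo = refl
      ; 1-homo = refl
      }

    fromℤ-≟ : ∀ i j → Maybe (fromℤ i ≈ fromℤ j)
    fromℤ-≟ i j with i ℤ.≟ j
    ... | yes ≡.refl = just refl
    ... | no  _      = nothing

  open RingSolver ℤ-rawRing (fromCommutativeRing R) fromℤ-morphism fromℤ-≟ public
    using (solve; _:=_; _:+_; _:*_; :-_; _:-_; con)

module Determinant {c ℓ : Level} (R : CommutativeRing c ℓ) where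
  open CommutativeRing R hiding (zero)
  open Matrices R
  open IntegerCoefficients R
  open import Algebra.Properties.Ring ring using (-‿involutive)
  open import Algebra.Properties.Group +-group using (inverseʳ-unique)
  open import Algebra.Properties.Semiring.Sum semiring
    using (sum; sum-cong-≋; ∑-distrib-+; ∑-comm; sum-remove; *-distribˡ-sum; sum-replicate-zero)
  open SetoidReasoning setoid

  Mat : ℕ → Set c
  Mat m = Fin m → Fin m → Carrier

  minor : ∀ {m} → Mat (suc m) → Fin (suc m) → Mat m
  minor M j r s = M (suc r) (punchIn j s)

  cofactorTerm : ∀ {m} → Mat (suc m) → Fin (suc m) → Carrier
  cofactorTerm M j = sgn (toℕ j) * (M zero j * det (minor M j))

  sumF≡sum : ∀ {m} (f : Fin m → Carrier) → sumF f ≡ sum f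
  sumF≡sum {zero}  f = ≡.refl
  sumF≡sum {suc m} f = ≡.cong (λ t → f zero + t) (sumF≡sum (λ j → f (suc j)))

  det-expand : ∀ {m} (M : Mat (suc m)) → det M ≡ sum (cofactorTerm M)
  det-expand M = sumF≡sum (cofactorTerm M)

  sum-cong : ∀ {m} (f g : Fin m → Carrier) → (∀ j → f j ≈ g j) → sum f ≈ sum g
  sum-cong f g = sum-cong-≋ {x = f} {y = g}

  sum-zero : ∀ {m} (f : Fin m → Carrier) → (∀ j → f j ≈ 0#) → sum f ≈ 0#
  sum-zero {m} f f≈0 = trans (sum-cong f _ f≈0) (sum-replicate-zero m)

  sum-single : ∀ {m} (f : Fin (suc m) → Carrier) (k : Fin (suc m)) →
               (∀ j → j ≢ k → f j ≈ 0#) → sum f ≈ f k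
  sum-single f k f≈0 = begin
    sum f                              ≈⟨ sum-remove {i = k} f ⟩
    f k + sum (λ j → f (punchIn k j))  ≈⟨ +-congˡ (sum-zero _ (λ j → f≈0 _ (Fin.punchInᵢ≢i k j))) ⟩
    f k + 0#                           ≈⟨ +-identityʳ _ ⟩
    f k                                ∎

  det-congMinors : ∀ {m} (M N : Mat (suc m)) → (∀ j → M zero j ≈ N zero j) →
                   (∀ j → det (minor M j) ≈ det (minor N j)) → det M ≈ det N
  det-congMinors M N row₀ minors = begin
    det M                  ≡⟨ det-expand M ⟩
    sum (cofactorTerm M)   ≈⟨ sum-cong (cofactorTerm M) (cofactorTerm N) (λ j → *-congˡ (*-cong (row₀ j) (minors j))) ⟩
    sum (cofactorTerm N)   ≡⟨ det-expand N ⟨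
    det N                  ∎

  det-cong : ∀ {m} {M N : Mat m} → (∀ i j → M i j ≈ N i j) → det M ≈ det N
  det-cong {zero}          M≈N = refl
  det-cong {suc m} {M} {N} M≈N = det-congMinors M N (M≈N zero) (λ j → det-cong (λ r s → M≈N (suc r) (punchIn j s)))

  det-termsZero : ∀ {m} (M : Mat (suc m)) → (∀ j → cofactorTerm M j ≈ 0#) → det M ≈ 0#
  det-termsZero M terms≈0 = ≡.subst (_≈ 0#) (≡.sym (det-expand M)) (sum-zero _ terms≈0)

  det-minorsZero : ∀ {m} (M : Mat (suc m)) → (∀ j → det (minor M j) ≈ 0#) → det M ≈ 0#
  det-minorsZero M minors≈0 = det-termsZero M (λ j → trans (*-congˡ (trans (*-congˡ (minors≈0 j)) (zeroʳ _))) (zeroʳ _))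

  det-zeroRow : ∀ {m} (k : Fin m) (M : Mat m) → (∀ j → M k j ≈ 0#) → det M ≈ 0#
  det-zeroRow zero    M row≈0 = det-termsZero M (λ j → trans (*-congˡ (trans (*-congʳ (row≈0 j)) (zeroˡ _))) (zeroʳ _))
  det-zeroRow (suc k) M row≈0 = det-minorsZero M (λ j → det-zeroRow k (minor M j) (λ s → row≈0 (punchIn j s)))

  det-zeroColumn₀ : ∀ {m} (M : Mat (suc m)) → (∀ i → M i zero ≈ 0#) → det M ≈ 0#
  det-zeroColumn₀ {m} M col≈0 = det-termsZero M term≈0
    where
    term≈0 : ∀ j → cofactorTerm M j ≈ 0#
    term≈0 zero = trans (*-congˡ (trans (*-congʳ (col≈0 zero)) (zeroˡ _))) (zeroʳ _)
    term≈0 (suc {suc _} j) =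
      trans (*-congˡ (trans (*-congˡ (det-zeroColumn₀ (minor M (suc j)) (col≈0 ∘ suc))) (zeroʳ _))) (zeroʳ _)

  det-expandSingle : ∀ {m} (l : Fin (suc m)) (M : Mat (suc m)) → (∀ j → j ≢ l → M zero j ≈ 0#) →
                     det M ≈ sgn (toℕ l) * (M zero l * det (minor M l))
  det-expandSingle l M row≈0 = ≡.subst (_≈ cofactorTerm M l) (≡.sym (det-expand M))
    (sum-single (cofactorTerm M) l (λ j j≢l → trans (*-congˡ (trans (*-congʳ (row≈0 j j≢l)) (zeroˡ _))) (zeroʳ _)))

  det-blockTriangular : ∀ {m} (M : Mat (suc m)) → (∀ i → M (suc i) zero ≈ 0#) →
                        det M ≈ M zero zero * det (λ i j → M (suc i) (suc j))
  det-blockTriangular {zero}  M col≈0 = trans (+-identityʳ _) (*-identityˡ _)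
  det-blockTriangular {suc m} M col≈0 = begin
    det M                                              ≡⟨ det-expand M ⟩
    cofactorTerm M zero + sum (cofactorTerm M ∘ suc)   ≈⟨ +-congˡ (laterTerms-zero (λ j → det-zeroColumn₀ (minor M (suc j)) col≈0)) ⟩
    cofactorTerm M zero + 0#                           ≈⟨ trans (+-identityʳ _) (*-identityˡ _) ⟩
    M zero zero * det (λ i j → M (suc i) (suc j))      ∎
    where
    laterTerms-zero : (∀ j → det (minor M (suc j)) ≈ 0#) → sum (cofactorTerm M ∘ suc) ≈ 0#
    laterTerms-zero minors≈0 = sum-zero (cofactorTerm M ∘ suc) (λ j → trans (*-congˡ (trans (*-congˡ (minors≈0 j)) (zeroʳ _))) (zeroʳ _))

  private
    ∑-linear : ∀ {m} (a : Carrier) (f g : Fin m → Carrier) → sum (λ j → a * f j + g j) ≈ a * sum f + sum g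
    ∑-linear a f g = trans (∑-distrib-+ (λ j → a * f j) g) (+-congʳ (sym (*-distribˡ-sum a f)))

    det-linearTerms : ∀ {m} (a : Carrier) (M A B : Mat (suc m)) →
                      (∀ j → cofactorTerm M j ≈ a * cofactorTerm A j + cofactorTerm B j) →
                      det M ≈ a * det A + det B
    det-linearTerms a M A B terms = begin
      det M                                                  ≡⟨ det-expand M ⟩
      sum (cofactorTerm M)                                   ≈⟨ sum-cong (cofactorTerm M) _ terms ⟩
      sum (λ j → a * cofactorTerm A j + cofactorTerm B j)    ≈⟨ ∑-linear a (cofactorTerm A) (cofactorTerm B) ⟩
      a * sum (cofactorTerm A) + sum (cofactorTerm B)        ≡⟨ ≡.cong₂ (λ u v → a * u + v) (det-expand A) (det-expand B) ⟨
      a * det A + det B                                      ∎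

  det-linear : ∀ {m} (k : Fin m) (a : Carrier) (M A B : Mat m) →
               (∀ j → M k j ≈ a * A k j + B k j) →
               (∀ i → i ≢ k → ∀ j → M i j ≈ A i j) →
               (∀ i → i ≢ k → ∀ j → M i j ≈ B i j) →
               det M ≈ a * det A + det B
  det-linear zero a M A B rowₖ M≈A M≈B = det-linearTerms a M A B term
    where
    term : ∀ j → cofactorTerm M j ≈ a * cofactorTerm A j + cofactorTerm B j
    term j = begin
      sgn (toℕ j) * (M zero j * det (minor M j))
        ≈⟨ *-congˡ (*-congʳ (rowₖ j)) ⟩
      sgn (toℕ j) * ((a * A zero j + B zero j) * det (minor M j))
        ≈⟨ solve 5 (λ s a x y d → s :* ((a :* x :+ y) :* d) := a :* (s :* (x :* d)) :+ s :* (y :* d)) refl _ _ _ _ _ ⟩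
      a * (sgn (toℕ j) * (A zero j * det (minor M j))) + sgn (toℕ j) * (B zero j * det (minor M j))
        ≈⟨ +-cong (*-congˡ (*-congˡ (*-congˡ (det-cong (λ r s → M≈A (suc r) (λ ()) (punchIn j s))))))
                  (*-congˡ (*-congˡ (det-cong (λ r s → M≈B (suc r) (λ ()) (punchIn j s))))) ⟩
      a * cofactorTerm A j + cofactorTerm B j
        ∎
  det-linear (suc k) a M A B rowₖ M≈A M≈B = det-linearTerms a M A B term
    where
    term : ∀ j → cofactorTerm M j ≈ a * cofactorTerm A j + cofactorTerm B j
    term j = begin
      sgn (toℕ j) * (M zero j * det (minor M j))
        ≈⟨ *-congˡ (*-cong (M≈A zero (λ ()) j)
             (det-linear k a (minor M j) (minor A j) (minor B j) (λ s → rowₖ (punchIn j s))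
               (λ i i≢k s → M≈A (suc i) (i≢k ∘ Fin.suc-injective) (punchIn j s))
               (λ i i≢k s → M≈B (suc i) (i≢k ∘ Fin.suc-injective) (punchIn j s)))) ⟩
      sgn (toℕ j) * (A zero j * (a * det (minor A j) + det (minor B j)))
        ≈⟨ solve 5 (λ s a x u v → s :* (x :* (a :* u :+ v)) := a :* (s :* (x :* u)) :+ s :* (x :* v)) refl _ _ _ _ _ ⟩
      a * cofactorTerm A j + sgn (toℕ j) * (A zero j * det (minor B j))
        ≈⟨ +-congˡ (*-congˡ (*-congʳ (trans (sym (M≈A zero (λ ()) j)) (M≈B zero (λ ()) j)))) ⟩
      a * cofactorTerm A j + cofactorTerm B j
        ∎

  det-additive : ∀ {m} (k : Fin m) (M A B : Mat m) → (∀ j → M k j ≈ A k j + B k j) →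
                 (∀ i → i ≢ k → ∀ j → M i j ≈ A i j) → (∀ i → i ≢ k → ∀ j → M i j ≈ B i j) →
                 det M ≈ det A + det B
  det-additive k M A B rowₖ M≈A M≈B =
    trans (det-linear k 1# M A B (λ j → trans (rowₖ j) (+-congʳ (sym (*-identityˡ _)))) M≈A M≈B)
          (+-congʳ (*-identityˡ _))

  private
    punchIn-punchOut-comm : ∀ {m} (j l : Fin (suc (suc m))) (j≢l : j ≢ l) (l≢j : l ≢ j) (s : Fin m) →
                            punchIn j (punchIn (punchOut j≢l) s) ≡ punchIn l (punchIn (punchOut l≢j) s)
    punchIn-punchOut-comm zero    zero    j≢l _ s = ⊥-elim (j≢l ≡.refl)
    punchIn-punchOut-comm zero    (suc l) _   _ s = ≡.refl
    punchIn-punchOut-comm (suc j) zero    _   _ s = ≡.refl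
    punchIn-punchOut-comm {suc m} (suc j) (suc l) _ _ zero = ≡.refl
    punchIn-punchOut-comm {suc m} (suc j) (suc l) j≢l l≢j (suc s) =
      ≡.cong suc (punchIn-punchOut-comm j l (j≢l ∘ ≡.cong suc) (l≢j ∘ ≡.cong suc) s)

    sgn-punchOut-anti : ∀ {m} (j l : Fin (suc (suc m))) (j≢l : j ≢ l) (l≢j : l ≢ j) →
                        sgn (toℕ j) * sgn (toℕ (punchOut j≢l)) ≈ - (sgn (toℕ l) * sgn (toℕ (punchOut l≢j)))
    sgn-punchOut-anti zero    zero    j≢l _ = ⊥-elim (j≢l ≡.refl)
    sgn-punchOut-anti zero    (suc l) _   _ = solve 1 (λ x → con (+ 1) :* x := :- ((:- x) :* con (+ 1))) refl _
    sgn-punchOut-anti (suc j) zero    _   _ = solve 1 (λ x → (:- x) :* con (+ 1) := :- (con (+ 1) :* x)) refl _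
    sgn-punchOut-anti {zero}  (suc zero) (suc zero) j≢l _ = ⊥-elim (j≢l ≡.refl)
    sgn-punchOut-anti {suc m} (suc j) (suc l) j≢l l≢j = begin
      - sgn (toℕ j) * - sgn (toℕ (punchOut (j≢l ∘ ≡.cong suc)))
        ≈⟨ solve 2 (λ x y → (:- x) :* (:- y) := x :* y) refl _ _ ⟩
      sgn (toℕ j) * sgn (toℕ (punchOut (j≢l ∘ ≡.cong suc)))
        ≈⟨ sgn-punchOut-anti j l (j≢l ∘ ≡.cong suc) (l≢j ∘ ≡.cong suc) ⟩
      - (sgn (toℕ l) * sgn (toℕ (punchOut (l≢j ∘ ≡.cong suc))))
        ≈⟨ -‿cong (solve 2 (λ x y → x :* y := (:- x) :* (:- y)) refl _ _) ⟩
      - (- sgn (toℕ l) * - sgn (toℕ (punchOut (l≢j ∘ ≡.cong suc))))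
        ∎

    ∑∑-antisymmetric : ∀ {m} (h : Fin m → Fin m → Carrier) → (∀ i → h i i ≈ 0#) →
                       (∀ i j → i ≢ j → h i j + h j i ≈ 0#) → sum (λ i → sum (h i)) ≈ 0#
    ∑∑-antisymmetric {zero}  h diag anti = refl
    ∑∑-antisymmetric {suc m} h diag anti = begin
      (h zero zero + sum (h zero ∘ suc)) + sum (λ i → h (suc i) zero + sum (h (suc i) ∘ suc))
        ≈⟨ +-cong (+-congʳ (diag zero)) (∑-distrib-+ (λ i → h (suc i) zero) (λ i → sum (h (suc i) ∘ suc))) ⟩
      (0# + sum (h zero ∘ suc)) + (sum (λ i → h (suc i) zero) + sum (λ i → sum (h (suc i) ∘ suc)))
        ≈⟨ +-congˡ (+-congˡ (∑∑-antisymmetric (λ i j → h (suc i) (suc j)) (diag ∘ suc)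
                              (λ i j i≢j → anti (suc i) (suc j) (i≢j ∘ Fin.suc-injective)))) ⟩
      (0# + sum (h zero ∘ suc)) + (sum (λ i → h (suc i) zero) + 0#)
        ≈⟨ solve 2 (λ a b → (con (+ 0) :+ a) :+ (b :+ con (+ 0)) := a :+ b) refl _ _ ⟩
      sum (h zero ∘ suc) + sum (λ i → h (suc i) zero)
        ≈⟨ ∑-distrib-+ (h zero ∘ suc) (λ i → h (suc i) zero) ⟨
      sum (λ j → h zero (suc j) + h (suc j) zero)
        ≈⟨ sum-zero _ (λ j → anti zero (suc j) (λ ())) ⟩
      0# ∎

  -- Expanding twice, det M is the double sum of the terms for the pairs (j , l) of
  -- distinct columns hit by rows 0 and 1; the terms for (j , l) and (l , j) cancel.
  det-equalRows₀₁ : ∀ {m} (M : Mat (suc (suc m))) → (∀ j → M (suc zero) j ≈ M zero j) → det M ≈ 0#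
  det-equalRows₀₁ {m} M row₁≈row₀ = begin
    det M                          ≡⟨ det-expand M ⟩
    sum (cofactorTerm M)           ≈⟨ sum-cong (cofactorTerm M) _ row ⟩
    sum (λ j → sum (h j))          ≈⟨ ∑∑-antisymmetric h h-diag h-anti ⟩
    0#                             ∎
    where
    D₂ : ∀ j → Fin (suc m) → Carrier
    D₂ j l = det (minor (minor M j) l)

    pairTerm : (j l : Fin (suc (suc m))) → j ≢ l → Carrier
    pairTerm j l j≢l = sgn (toℕ j) * (M zero j * (sgn (toℕ (punchOut j≢l)) * (M zero l * D₂ j (punchOut j≢l))))

    h : Fin (suc (suc m)) → Fin (suc (suc m)) → Carrier
    h j l with j Fin.≟ l
    ... | yes _   = 0#
    ... | no  j≢l = pairTerm j l j≢l

    h-diag : ∀ j → h j j ≈ 0#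
    h-diag j with j Fin.≟ j
    ... | yes _   = refl
    ... | no  j≢j = ⊥-elim (j≢j ≡.refl)

    h-anti : ∀ j l → j ≢ l → h j l + h l j ≈ 0#
    h-anti j l j≢l with j Fin.≟ l | l Fin.≟ j
    ... | yes j≡l | _       = ⊥-elim (j≢l j≡l)
    ... | no _    | yes l≡j = ⊥-elim (j≢l (≡.sym l≡j))
    ... | no j≢l′ | no l≢j  = begin
      s₁ * (x * (s₂ * (y * D₂ j (punchOut j≢l′)))) + t₁ * (y * (t₂ * (x * D₂ l (punchOut l≢j))))
        ≈⟨ +-congˡ (*-congˡ (*-congˡ (*-congˡ (*-congˡ (sym same-minor))))) ⟩
      s₁ * (x * (s₂ * (y * d))) + t₁ * (y * (t₂ * (x * d)))
        ≈⟨ solve 7 (λ s₁ s₂ t₁ t₂ x y d → s₁ :* (x :* (s₂ :* (y :* d))) :+ t₁ :* (y :* (t₂ :* (x :* d)))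
                                          := (s₁ :* s₂ :+ t₁ :* t₂) :* (x :* (y :* d))) refl s₁ s₂ t₁ t₂ x y d ⟩
      (s₁ * s₂ + t₁ * t₂) * (x * (y * d))
        ≈⟨ *-congʳ (+-congʳ (sgn-punchOut-anti j l j≢l′ l≢j)) ⟩
      (- (t₁ * t₂) + t₁ * t₂) * (x * (y * d))
        ≈⟨ solve 2 (λ a b → (:- a :+ a) :* b := con (+ 0)) refl (t₁ * t₂) (x * (y * d)) ⟩
      0# ∎
      where
      s₁ = sgn (toℕ j)
      s₂ = sgn (toℕ (punchOut j≢l′))
      t₁ = sgn (toℕ l)
      t₂ = sgn (toℕ (punchOut l≢j))
      x = M zero j
      y = M zero l
      d = D₂ j (punchOut j≢l′)
      same-minor : d ≈ D₂ l (punchOut l≢j)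
      same-minor = det-cong (λ r s → reflexive (≡.cong (M (suc (suc r))) (punchIn-punchOut-comm j l j≢l′ l≢j s)))

    h-punchIn : ∀ j l → h j (punchIn j l) ≡ sgn (toℕ j) * (M zero j * (sgn (toℕ l) * (M zero (punchIn j l) * D₂ j l)))
    h-punchIn j l with j Fin.≟ punchIn j l
    ... | yes j≡ = ⊥-elim (Fin.punchInᵢ≢i j l (≡.sym j≡))
    ... | no j≢ rewrite ≡.trans (Fin.punchOut-cong j {i≢j = j≢} ≡.refl) (Fin.punchOut-punchIn j {l}) = ≡.refl

    row : ∀ j → cofactorTerm M j ≈ sum (h j)
    row j = begin
      sgn (toℕ j) * (M zero j * det (minor M j))
        ≡⟨ ≡.cong (λ d → sgn (toℕ j) * (M zero j * d)) (det-expand (minor M j)) ⟩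
      sgn (toℕ j) * (M zero j * sum (cofactorTerm (minor M j)))
        ≈⟨ *-congˡ (*-distribˡ-sum (M zero j) (cofactorTerm (minor M j))) ⟩
      sgn (toℕ j) * sum (λ l → M zero j * cofactorTerm (minor M j) l)
        ≈⟨ *-distribˡ-sum (sgn (toℕ j)) (λ l → M zero j * cofactorTerm (minor M j) l) ⟩
      sum (λ l → sgn (toℕ j) * (M zero j * cofactorTerm (minor M j) l))
        ≈⟨ sum-cong _ _ (λ l → trans (*-congˡ (*-congˡ (*-congˡ (*-congʳ (row₁≈row₀ (punchIn j l))))))
                                     (reflexive (≡.sym (h-punchIn j l)))) ⟩
      sum (λ l → h j (punchIn j l))
        ≈⟨ +-identityˡ _ ⟨
      0# + sum (λ l → h j (punchIn j l))
        ≈⟨ +-congʳ (h-diag j) ⟨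
      h j j + sum (λ l → h j (punchIn j l))
        ≈⟨ sum-remove {i = j} (h j) ⟨
      sum (h j) ∎

  swap₀₁ : ∀ {a} {A : Set a} {m} → (Fin (suc (suc m)) → A) → Fin (suc (suc m)) → A
  swap₀₁ f zero          = f (suc zero)
  swap₀₁ f (suc zero)    = f zero
  swap₀₁ f (suc (suc i)) = f (suc (suc i))

  withRows₀₁ : ∀ {m} → Mat (suc (suc m)) → (u v : Fin (suc (suc m)) → Carrier) → Mat (suc (suc m))
  withRows₀₁ M u v zero          = u
  withRows₀₁ M u v (suc zero)    = v
  withRows₀₁ M u v (suc (suc i)) = M (suc (suc i))

  -- Multilinearity in rows 0 and 1 expands det (u + v , u + v) = 0 into det (u , v) + det (v , u).
  det-swap₀₁ : ∀ {m} (M : Mat (suc (suc m))) → det (swap₀₁ M) ≈ - det M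
  det-swap₀₁ M = inverseʳ-unique (det M) (det (swap₀₁ M)) (begin
    det M + det (swap₀₁ M)
      ≈⟨ +-cong (det-cong {M = M} {N = W u v} λ { zero j → refl ; (suc zero) j → refl ; (suc (suc i)) j → refl })
                (det-cong {M = swap₀₁ M} {N = W v u} λ { zero j → refl ; (suc zero) j → refl ; (suc (suc i)) j → refl }) ⟩
    det (W u v) + det (W v u)
      ≈⟨ +-cong (trans (+-congʳ (det-equalRows₀₁ (W u u) (λ j → refl))) (+-identityˡ _))
                (trans (+-congˡ (det-equalRows₀₁ (W v v) (λ j → refl))) (+-identityʳ _)) ⟨
    (det (W u u) + det (W u v)) + (det (W v u) + det (W v v))
      ≈⟨ +-cong (det-additive (suc zero) (W u w) (W u u) (W u v) (λ j → refl) away₁ away₁)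
                (det-additive (suc zero) (W v w) (W v u) (W v v) (λ j → refl) away₁ away₁) ⟨
    det (W u w) + det (W v w)
      ≈⟨ det-additive zero (W w w) (W u w) (W v w) (λ j → refl) away₀ away₀ ⟨
    det (W w w)
      ≈⟨ det-equalRows₀₁ (W w w) (λ j → refl) ⟩
    0# ∎)
    where
    W = withRows₀₁ M
    u = M zero
    v = M (suc zero)
    w = λ j → u j + v j

    away₀ : ∀ {r r′ s} i → i ≢ zero → ∀ j → W r s i j ≈ W r′ s i j
    away₀ zero          i≢0 j = ⊥-elim (i≢0 ≡.refl)
    away₀ (suc zero)    _   j = refl
    away₀ (suc (suc i)) _   j = refl

    away₁ : ∀ {r s s′} i → i ≢ suc zero → ∀ j → W r s i j ≈ W r s′ i j
    away₁ zero          _   j = refl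
    away₁ (suc zero)    i≢1 j = ⊥-elim (i≢1 ≡.refl)
    away₁ (suc (suc i)) _   j = refl

  det-equalRow₀ : ∀ {m} (M : Mat (suc m)) (l : Fin m) → (∀ j → M zero j ≈ M (suc l) j) → det M ≈ 0#
  det-equalRow₀ M zero    row₀≈rowₗ = det-equalRows₀₁ M (sym ∘ row₀≈rowₗ)
  det-equalRow₀ M (suc l) row₀≈rowₗ = begin
    det M                ≈⟨ -‿involutive (det M) ⟨
    - - det M            ≈⟨ -‿cong (det-swap₀₁ M) ⟨
    - det (swap₀₁ M)     ≈⟨ -‿cong (det-minorsZero (swap₀₁ M) λ j →
                              det-equalRow₀ (minor (swap₀₁ M) j) l (λ s → row₀≈rowₗ (punchIn j s))) ⟩
    - 0#                 ≈⟨ solve 0 (:- con (+ 0) := con (+ 0)) refl ⟩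
    0#                   ∎

  det-equalRows : ∀ {m} (M : Mat m) (i l : Fin m) → i ≢ l → (∀ j → M i j ≈ M l j) → det M ≈ 0#
  det-equalRows M zero    zero    i≢l _         = ⊥-elim (i≢l ≡.refl)
  det-equalRows M zero    (suc l) _   rowᵢ≈rowₗ = det-equalRow₀ M l rowᵢ≈rowₗ
  det-equalRows M (suc i) zero    _   rowᵢ≈rowₗ = det-equalRow₀ M i (sym ∘ rowᵢ≈rowₗ)
  det-equalRows M (suc i) (suc l) i≢l rowᵢ≈rowₗ =
    det-minorsZero M (λ j → det-equalRows (minor M j) i l (i≢l ∘ ≡.cong suc) (λ s → rowᵢ≈rowₗ (punchIn j s)))

  withRow₀ : ∀ {m} → Mat (suc m) → (Fin (suc m) → Carrier) → Mat (suc m)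
  withRow₀ M r zero    = r
  withRow₀ M r (suc i) = M (suc i)

  addMultiplesOfRow : ∀ {m} → Fin m → (Fin m → Carrier) → Mat m → Mat m
  addMultiplesOfRow k c M i j = M i j + c i * M k j

  det-addMultiplesOfRow    : ∀ {m} (k : Fin m) (c : Fin m → Carrier) (M : Mat m) → c k ≈ 0# →
                             det (addMultiplesOfRow k c M) ≈ det M
  det-addMultiplesOfSucRow : ∀ {m} (k : Fin m) (c : Fin (suc m) → Carrier) (M : Mat (suc m)) → c (suc k) ≈ 0# →
                             det (addMultiplesOfRow (suc k) c M) ≈ det M

  det-addMultiplesOfRow (suc k) c M cₖ≈0 = det-addMultiplesOfSucRow k c M cₖ≈0
  det-addMultiplesOfRow {suc zero} zero c M c₀≈0 =
    det-cong {M = addMultiplesOfRow zero c M} {N = M} λ { zero j → trans (+-congˡ (trans (*-congʳ c₀≈0) (zeroˡ _))) (+-identityʳ _) }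
  det-addMultiplesOfRow {suc (suc m)} zero c M c₀≈0 = begin
    det (addMultiplesOfRow zero c M)
      ≈⟨ -‿involutive _ ⟨
    - - det (addMultiplesOfRow zero c M)
      ≈⟨ -‿cong (det-swap₀₁ (addMultiplesOfRow zero c M)) ⟨
    - det (swap₀₁ (addMultiplesOfRow zero c M))
      ≈⟨ -‿cong (det-cong {M = swap₀₁ (addMultiplesOfRow zero c M)} {N = addMultiplesOfRow (suc zero) (swap₀₁ c) (swap₀₁ M)}
                   λ { zero j → refl ; (suc zero) j → refl ; (suc (suc i)) j → refl }) ⟩
    - det (addMultiplesOfRow (suc zero) (swap₀₁ c) (swap₀₁ M))
      ≈⟨ -‿cong (det-addMultiplesOfSucRow zero (swap₀₁ c) (swap₀₁ M) c₀≈0) ⟩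
    - det (swap₀₁ M)
      ≈⟨ -‿cong (det-swap₀₁ M) ⟩
    - - det M
      ≈⟨ -‿involutive _ ⟩
    det M ∎

  -- Split row 0 by linearity: one part has equal rows 0 and k + 1, the other has the row 0
  -- of M and minors of the same form.
  det-addMultiplesOfSucRow k c M cₖ≈0 = begin
    det M′                         ≈⟨ det-linear zero (c zero) M′ (withRow₀ M′ (M (suc k))) (withRow₀ M′ (M zero))
                                        (λ j → +-comm _ _) others others ⟩
    c zero * det (withRow₀ M′ (M (suc k))) + det (withRow₀ M′ (M zero))
                                   ≈⟨ +-cong (*-congˡ (det-equalRow₀ (withRow₀ M′ (M (suc k))) k (λ j → sym rowₖ-unchanged)))
                                             (det-congMinors (withRow₀ M′ (M zero)) M (λ j → refl)
                                               (λ j → det-addMultiplesOfRow k (c ∘ suc) (minor M j) cₖ≈0)) ⟩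
    c zero * 0# + det M            ≈⟨ trans (+-congʳ (zeroʳ _)) (+-identityˡ _) ⟩
    det M                          ∎
    where
    M′ = addMultiplesOfRow (suc k) c M

    others : ∀ {r} i → i ≢ zero → ∀ j → M′ i j ≈ withRow₀ M′ r i j
    others zero    i≢0 j = ⊥-elim (i≢0 ≡.refl)
    others (suc i) _   j = refl

    rowₖ-unchanged : ∀ {j} → M′ (suc k) j ≈ M (suc k) j
    rowₖ-unchanged = trans (+-congˡ (trans (*-congʳ cₖ≈0) (zeroˡ _))) (+-identityʳ _)

  det-addCombinationToRow₀ : ∀ {m} (c : Fin m → Carrier) (M : Mat (suc m)) →
                             det (withRow₀ M (λ j → M zero j + sum (λ i → c i * M (suc i) j))) ≈ det M
  det-addCombinationToRow₀ {m} c M = begin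
    det M′
      ≡⟨ det-expand M′ ⟩
    sum (cofactorTerm M′)
      ≈⟨ sum-cong (cofactorTerm M′) _ term ⟩
    sum (λ j → cofactorTerm M j + sum (λ i → c i * X i j))
      ≈⟨ ∑-distrib-+ (cofactorTerm M) (λ j → sum (λ i → c i * X i j)) ⟩
    sum (cofactorTerm M) + sum (λ j → sum (λ i → c i * X i j))
      ≈⟨ +-congˡ (∑-comm (λ i j → c i * X i j)) ⟨
    sum (cofactorTerm M) + sum (λ i → sum (λ j → c i * X i j))
      ≈⟨ +-congˡ (sum-zero _ (λ i → trans (sym (*-distribˡ-sum (c i) (X i)))
                     (trans (*-congˡ (≡.subst (_≈ 0#) (det-expand (withRow₀ M (M (suc i))))
                                        (det-equalRow₀ (withRow₀ M (M (suc i))) i (λ j → refl))))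
                            (zeroʳ _)))) ⟩
    sum (cofactorTerm M) + 0#
      ≈⟨ +-identityʳ _ ⟩
    sum (cofactorTerm M)
      ≡⟨ det-expand M ⟨
    det M ∎
    where
    M′ = withRow₀ M (λ j → M zero j + sum (λ i → c i * M (suc i) j))

    X : Fin m → Fin (suc m) → Carrier
    X i = cofactorTerm (withRow₀ M (M (suc i)))

    term : ∀ j → cofactorTerm M′ j ≈ cofactorTerm M j + sum (λ i → c i * X i j)
    term j = begin
      s * ((M zero j + sum (λ i → c i * M (suc i) j)) * d)
        ≈⟨ solve 4 (λ s a S d → s :* ((a :+ S) :* d) := s :* (a :* d) :+ (s :* d) :* S) refl s _ _ d ⟩
      cofactorTerm M j + (s * d) * sum (λ i → c i * M (suc i) j)
        ≈⟨ +-congˡ (*-distribˡ-sum (s * d) (λ i → c i * M (suc i) j)) ⟩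
      cofactorTerm M j + sum (λ i → (s * d) * (c i * M (suc i) j))
        ≈⟨ +-congˡ (sum-cong _ _ (λ i → solve 4 (λ s d c x → (s :* d) :* (c :* x) := c :* (s :* (x :* d))) refl s d (c i) _)) ⟩
      cofactorTerm M j + sum (λ i → c i * X i j) ∎
      where
      s = sgn (toℕ j)
      d = det (minor M j)

  scalarMatrix : ∀ q → Carrier → Mat q
  scalarMatrix q d i j = if does (i Fin.≟ j) then d else 0#

  det-scalarMatrix : ∀ q d → det (scalarMatrix q d) ≈ d ^ q
  det-scalarMatrix zero    d = refl
  det-scalarMatrix (suc q) d = trans (det-blockTriangular (scalarMatrix (suc q) d) (λ i → refl)) (*-congˡ (det-scalarMatrix q d))

module BlockDeterminants {r ℓ : Level} (R : CommutativeRing r ℓ) where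
  open CommutativeRing R hiding (zero)
  open Matrices R
  open IntegerCoefficients R
  open Determinant R
  open import Algebra.Properties.Ring ring using (-‿involutive)
  open SetoidReasoning setoid

  arrowhead : ∀ q → Carrier → Carrier → Mat (suc q)
  arrowhead q c d zero    zero    = 0#
  arrowhead q c d zero    (suc j) = 1#
  arrowhead q c d (suc i) zero    = c
  arrowhead q c d (suc i) (suc j) = scalarMatrix q d i j

  private
    unitRow₀ : ∀ {m} → Fin (suc m) → Carrier
    unitRow₀ zero    = 1#
    unitRow₀ (suc j) = 0#

    -- [[1, 0], [-d 𝟙, dI]] becomes triangular after adding d times row 0 to the rows below.
    det-unitRow₀ : ∀ q d → det (withRow₀ (arrowhead q (- d) d) unitRow₀) ≈ d ^ q
    det-unitRow₀ q d = begin
      det M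
        ≈⟨ det-addMultiplesOfRow zero κ M refl ⟨
      det (addMultiplesOfRow zero κ M)
        ≈⟨ det-blockTriangular (addMultiplesOfRow zero κ M) (λ i → solve 1 (λ d → :- d :+ d :* con (+ 1) := con (+ 0)) refl d) ⟩
      (1# + 0# * 1#) * det (λ i j → scalarMatrix q d i j + d * 0#)
        ≈⟨ *-cong (solve 0 (con (+ 1) :+ con (+ 0) :* con (+ 1) := con (+ 1)) refl)
                  (det-cong {N = scalarMatrix q d} (λ i j → solve 2 (λ x d → x :+ d :* con (+ 0) := x) refl _ d)) ⟩
      1# * det (scalarMatrix q d)
        ≈⟨ trans (*-identityˡ _) (det-scalarMatrix q d) ⟩
      d ^ q ∎
      where
      M = withRow₀ (arrowhead q (- d) d) unitRow₀
      κ : Fin (suc q) → Carrier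
      κ zero    = 0#
      κ (suc i) = d

    natR-*-^ : ∀ q d → natR q * (d * d ^ (q ∸ 1)) ≈ natR q * d ^ q
    natR-*-^ zero    d = trans (zeroˡ _) (sym (zeroˡ _))
    natR-*-^ (suc q) d = refl

  -- Subtracting row 1 from the rows below and swapping rows 0 and 1 leaves c times a
  -- matrix whose row 0 is all ones; splitting that row gives the recursion.
  det-arrowhead : ∀ q c d → det (arrowhead q c d) ≈ - (natR q * (c * d ^ (q ∸ 1)))
  det-arrowhead zero    c d = solve 1 (λ c → con (+ 1) :* (con (+ 0) :* con (+ 1)) :+ con (+ 0) := :- (con (+ 0) :* (c :* con (+ 1)))) refl c
  det-arrowhead (suc q) c d = begin
    det P
      ≈⟨ det-addMultiplesOfRow (suc zero) κ P refl ⟨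
    det P′
      ≈⟨ -‿involutive _ ⟨
    - - det P′
      ≈⟨ -‿cong (det-swap₀₁ P′) ⟨
    - det (swap₀₁ P′)
      ≈⟨ -‿cong (det-blockTriangular (swap₀₁ P′) λ
           { zero    → solve 1 (λ c → con (+ 0) :+ con (+ 0) :* c := con (+ 0)) refl c
           ; (suc i) → solve 1 (λ c → c :+ con -[1+ 0 ] :* c := con (+ 0)) refl c }) ⟩
    - ((c + 0# * c) * det Θ)
      ≈⟨ -‿cong (*-congʳ (solve 1 (λ c → c :+ con (+ 0) :* c := c) refl c)) ⟩
    - (c * det Θ)
      ≈⟨ -‿cong (*-congˡ (det-additive zero Θ (withRow₀ Θ unitRow₀) (arrowhead q (- d) d) row₀
           (λ { zero i≢0 → ⊥-elim (i≢0 ≡.refl) ; (suc i) _ j → refl }) below)) ⟩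
    - (c * (det (withRow₀ Θ unitRow₀) + det (arrowhead q (- d) d)))
      ≈⟨ -‿cong (*-congˡ (+-cong
           (det-cong {M = withRow₀ Θ unitRow₀} {N = withRow₀ (arrowhead q (- d) d) unitRow₀}
             λ { zero j → refl ; (suc i) j → below (suc i) (λ ()) j })
           (det-arrowhead q (- d) d))) ⟩
    - (c * (det (withRow₀ (arrowhead q (- d) d) unitRow₀) + - (natR q * (- d * d ^ (q ∸ 1)))))
      ≈⟨ -‿cong (*-congˡ (+-congʳ (det-unitRow₀ q d))) ⟩
    - (c * (d ^ q + - (natR q * (- d * d ^ (q ∸ 1)))))
      ≈⟨ solve 5 (λ c d e N D → :- (c :* (D :+ :- (N :* ((:- d) :* e)))) := :- (c :* D :+ c :* (N :* (d :* e)))) refl c d (d ^ (q ∸ 1)) (natR q) (d ^ q) ⟩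
    - (c * d ^ q + c * (natR q * (d * d ^ (q ∸ 1))))
      ≈⟨ -‿cong (+-congˡ (*-congˡ (natR-*-^ q d))) ⟩
    - (c * d ^ q + c * (natR q * d ^ q))
      ≈⟨ solve 3 (λ c N D → :- (c :* D :+ c :* (N :* D)) := :- ((con (+ 1) :+ N) :* (c :* D))) refl c (natR q) (d ^ q) ⟩
    - (natR (suc q) * (c * d ^ q)) ∎
    where
    P = arrowhead (suc q) c d
    κ : Fin (suc (suc q)) → Carrier
    κ zero          = 0#
    κ (suc zero)    = 0#
    κ (suc (suc i)) = - 1#
    P′ = addMultiplesOfRow (suc zero) κ P
    Θ : Mat (suc q)
    Θ i j = swap₀₁ P′ (suc i) (suc j)
    row₀ : ∀ j → Θ zero j ≈ withRow₀ Θ unitRow₀ zero j + arrowhead q (- d) d zero j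
    row₀ zero    = solve 1 (λ x → con (+ 1) :+ con (+ 0) :* x := con (+ 1) :+ con (+ 0)) refl _
    row₀ (suc j) = solve 1 (λ x → con (+ 1) :+ con (+ 0) :* x := con (+ 0) :+ con (+ 1)) refl _
    below : ∀ i → i ≢ zero → ∀ j → Θ i j ≈ arrowhead q (- d) d i j
    below zero    i≢0 j       = ⊥-elim (i≢0 ≡.refl)
    below (suc i) _   zero    = solve 1 (λ d → con (+ 0) :+ con -[1+ 0 ] :* d := :- d) refl d
    below (suc i) _   (suc j) = solve 1 (λ x → x :+ con -[1+ 0 ] :* con (+ 0) := x) refl _

  module _ (a b c d : Carrier) where

    blockMatrix : ∀ p q → Mat (p ℕ.+ q)
    blockMatrix p q i j =
      if does (i Fin.≟ j) then (if toℕ i ℕ.<ᵇ p then a else d)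
      else (if toℕ i ℕ.<ᵇ p then (if toℕ j ℕ.<ᵇ p then 0# else b) else (if toℕ j ℕ.<ᵇ p then c else 0#))

    -- blockMatrix (suc p) q with row 0 replaced by the indicator of the second block, which
    -- is then used to clear the entries b from the other rows of the first block.
    borderedBlock : ∀ p q → Mat (suc p ℕ.+ q)
    borderedBlock p q zero    j = if toℕ j ℕ.<ᵇ suc p then 0# else 1#
    borderedBlock p q (suc i) j =
      if toℕ i ℕ.<ᵇ p then (if does (suc i Fin.≟ j) then a else 0#)
      else (if toℕ j ℕ.<ᵇ suc p then c else (if does (suc i Fin.≟ j) then d else 0#))

    det-borderedBlock : ∀ p q → det (borderedBlock p q) ≈ a ^ p * det (arrowhead q c d)
    det-borderedBlock zero    q = trans (det-cong {M = borderedBlock zero q} {N = arrowhead q c d}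
      λ { zero zero → refl ; zero (suc j) → refl ; (suc i) zero → refl ; (suc i) (suc j) → refl }) (sym (*-identityˡ _))
    det-borderedBlock (suc p) q = begin
      det Y
        ≈⟨ -‿involutive _ ⟨
      - - det Y
        ≈⟨ -‿cong (det-swap₀₁ Y) ⟨
      - det (swap₀₁ Y)
        ≈⟨ -‿cong (det-expandSingle (suc zero) (swap₀₁ Y) λ { zero _ → refl ; (suc zero) j≢1 → ⊥-elim (j≢1 ≡.refl) ; (suc (suc j)) _ → refl }) ⟩
      - (- 1# * (a * det (minor (swap₀₁ Y) (suc zero))))
        ≈⟨ -‿cong (*-congˡ (*-congˡ (det-cong {M = minor (swap₀₁ Y) (suc zero)} {N = borderedBlock p q}
             λ { zero zero → refl ; zero (suc s) → refl ; (suc r) zero → refl ; (suc r) (suc s) → refl }))) ⟩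
      - (- 1# * (a * det (borderedBlock p q)))
        ≈⟨ solve 2 (λ a y → :- (con -[1+ 0 ] :* (a :* y)) := a :* y) refl a _ ⟩
      a * det (borderedBlock p q)
        ≈⟨ *-congˡ (det-borderedBlock p q) ⟩
      a * (a ^ p * det (arrowhead q c d))
        ≈⟨ *-assoc _ _ _ ⟨
      a ^ suc p * det (arrowhead q c d) ∎
      where
      Y = borderedBlock (suc p) q

    private
      det-blockMatrix-suc : ∀ p q → det (blockMatrix (suc p) q) ≈ a * det (blockMatrix p q) + b * det (borderedBlock p q)
      det-blockMatrix-suc p q = begin
        det G
          ≈⟨ det-linear zero a G (withRow₀ G unitRow₀) (withRow₀ G (λ j → b * indicator j)) row₀ others others ⟩
        a * det (withRow₀ G unitRow₀) + det (withRow₀ G (λ j → b * indicator j))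
          ≈⟨ +-cong (*-congˡ unitPart) indicatorPart ⟩
        a * det (blockMatrix p q) + b * det (borderedBlock p q) ∎
        where
        G = blockMatrix (suc p) q

        indicator : Fin (suc p ℕ.+ q) → Carrier
        indicator zero    = 0#
        indicator (suc j) = if toℕ j ℕ.<ᵇ p then 0# else 1#

        row₀ : ∀ j → G zero j ≈ a * unitRow₀ j + b * indicator j
        row₀ zero = solve 2 (λ a b → a := a :* con (+ 1) :+ b :* con (+ 0)) refl a b
        row₀ (suc j) with toℕ j ℕ.<ᵇ p
        ... | true  = solve 2 (λ a b → con (+ 0) := a :* con (+ 0) :+ b :* con (+ 0)) refl a b
        ... | false = solve 2 (λ a b → b := a :* con (+ 0) :+ b :* con (+ 1)) refl a b

        others : ∀ {r} i → i ≢ zero → ∀ j → G i j ≈ withRow₀ G r i j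
        others zero    i≢0 j = ⊥-elim (i≢0 ≡.refl)
        others (suc i) _   j = refl

        κ : Fin (suc p ℕ.+ q) → Carrier
        κ zero    = 0#
        κ (suc i) = if toℕ i ℕ.<ᵇ p then 0# else - c

        unitPart : det (withRow₀ G unitRow₀) ≈ det (blockMatrix p q)
        unitPart = begin
          det (withRow₀ G unitRow₀)
            ≈⟨ det-addMultiplesOfRow zero κ (withRow₀ G unitRow₀) refl ⟨
          det (addMultiplesOfRow zero κ (withRow₀ G unitRow₀))
            ≈⟨ det-blockTriangular (addMultiplesOfRow zero κ (withRow₀ G unitRow₀)) column₀ ⟩
          (1# + 0# * 1#) * det (λ i j → G (suc i) (suc j) + κ (suc i) * 0#)
            ≈⟨ *-cong (solve 0 (con (+ 1) :+ con (+ 0) :* con (+ 1) := con (+ 1)) refl)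
                      (det-cong {N = blockMatrix p q} (λ i j → trans (+-congˡ (zeroʳ _)) (+-identityʳ _))) ⟩
          1# * det (blockMatrix p q)
            ≈⟨ *-identityˡ _ ⟩
          det (blockMatrix p q) ∎
          where
          column₀ : ∀ i → G (suc i) zero + κ (suc i) * 1# ≈ 0#
          column₀ i with toℕ i ℕ.<ᵇ p
          ... | true  = solve 0 (con (+ 0) :+ con (+ 0) :* con (+ 1) := con (+ 0)) refl
          ... | false = solve 1 (λ c → c :+ (:- c) :* con (+ 1) := con (+ 0)) refl c

        κ′ : Fin (suc p ℕ.+ q) → Carrier
        κ′ zero    = 0#
        κ′ (suc i) = if toℕ i ℕ.<ᵇ p then - b else 0#

        S = withRow₀ G indicator

        cleared : ∀ i j → borderedBlock p q i j ≈ addMultiplesOfRow zero κ′ S i j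
        cleared zero zero    = solve 1 (λ x → x := x :+ con (+ 0) :* x) refl _
        cleared zero (suc j) = solve 1 (λ x → x := x :+ con (+ 0) :* x) refl _
        cleared (suc i) j with toℕ i ℕ.<ᵇ p in i<p
        cleared (suc i) zero | true = solve 1 (λ b → con (+ 0) := con (+ 0) :+ (:- b) :* con (+ 0)) refl b
        cleared (suc i) (suc j) | true with i Fin.≟ j
        cleared (suc i) (suc .i) | true | yes ≡.refl rewrite i<p =
          solve 2 (λ a b → a := a :+ (:- b) :* con (+ 0)) refl a b
        cleared (suc i) (suc j) | true | no _ with toℕ j ℕ.<ᵇ p
        ... | true  = solve 1 (λ b → con (+ 0) := con (+ 0) :+ (:- b) :* con (+ 0)) refl b
        ... | false = solve 1 (λ b → con (+ 0) := b :+ (:- b) :* con (+ 1)) refl b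
        cleared (suc i) zero | false = solve 1 (λ c → c := c :+ con (+ 0) :* con (+ 0)) refl c
        cleared (suc i) (suc j) | false with i Fin.≟ j
        cleared (suc i) (suc .i) | false | yes ≡.refl rewrite i<p = solve 2 (λ x y → x := x :+ con (+ 0) :* y) refl _ _
        cleared (suc i) (suc j) | false | no _ = solve 2 (λ x y → x := x :+ con (+ 0) :* y) refl _ _

        indicatorPart : det (withRow₀ G (λ j → b * indicator j)) ≈ b * det (borderedBlock p q)
        indicatorPart = begin
          det (withRow₀ G (λ j → b * indicator j))
            ≈⟨ det-linear zero b _ S (withRow₀ G (λ _ → 0#)) (λ j → sym (+-identityʳ _)) others′ others′ ⟩
          b * det S + det (withRow₀ G (λ _ → 0#))
            ≈⟨ +-cong (*-congˡ (trans (sym (det-addMultiplesOfRow zero κ′ S refl)) (sym (det-cong cleared))))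
                      (det-zeroRow zero (withRow₀ G (λ _ → 0#)) (λ j → refl)) ⟩
          b * det (borderedBlock p q) + 0#
            ≈⟨ +-identityʳ _ ⟩
          b * det (borderedBlock p q) ∎
          where
          others′ : ∀ {r r′} i → i ≢ zero → ∀ j → withRow₀ G r i j ≈ withRow₀ G r′ i j
          others′ zero    i≢0 j = ⊥-elim (i≢0 ≡.refl)
          others′ (suc i) _   j = refl

      det-blockMatrix-zero : ∀ q → det (blockMatrix 0 q) ≈ d ^ q
      det-blockMatrix-zero q = trans (det-cong {N = scalarMatrix q d} (λ i j → refl)) (det-scalarMatrix q d)

      det-blockMatrix-rec : ∀ p q → det (blockMatrix (suc p) q) ≈ a ^ p * (a * d ^ q + natR (suc p) * (b * det (arrowhead q c d)))
      det-blockMatrix-rec zero q = begin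
        det (blockMatrix 1 q)
          ≈⟨ det-blockMatrix-suc 0 q ⟩
        a * det (blockMatrix 0 q) + b * det (borderedBlock 0 q)
          ≈⟨ +-cong (*-congˡ (det-blockMatrix-zero q)) (*-congˡ (det-borderedBlock 0 q)) ⟩
        a * d ^ q + b * (1# * det (arrowhead q c d))
          ≈⟨ solve 4 (λ a D b P → a :* D :+ b :* (con (+ 1) :* P) := con (+ 1) :* (a :* D :+ (con (+ 1) :+ con (+ 0)) :* (b :* P))) refl a (d ^ q) b _ ⟩
        1# * (a * d ^ q + (1# + 0#) * (b * det (arrowhead q c d))) ∎
      det-blockMatrix-rec (suc p) q = begin
        det (blockMatrix (suc (suc p)) q)
          ≈⟨ det-blockMatrix-suc (suc p) q ⟩
        a * det (blockMatrix (suc p) q) + b * det (borderedBlock (suc p) q)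
          ≈⟨ +-cong (*-congˡ (det-blockMatrix-rec p q)) (*-congˡ (det-borderedBlock (suc p) q)) ⟩
        a * (a ^ p * (a * d ^ q + natR (suc p) * (b * P))) + b * ((a * a ^ p) * P)
          ≈⟨ solve 6 (λ a e D N b P → a :* (e :* (a :* D :+ N :* (b :* P))) :+ b :* ((a :* e) :* P)
                                     := (a :* e) :* (a :* D :+ (con (+ 1) :+ N) :* (b :* P))) refl a (a ^ p) (d ^ q) (natR (suc p)) b P ⟩
        (a * a ^ p) * (a * d ^ q + natR (suc (suc p)) * (b * P)) ∎
        where
        P = det (arrowhead q c d)

    det-blockMatrix : ∀ p q → det (blockMatrix (suc p) (suc q)) ≈ a ^ p * d ^ q * (a * d - natR (suc p) * natR (suc q) * (b * c))
    det-blockMatrix p q = begin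
      det (blockMatrix (suc p) (suc q))
        ≈⟨ det-blockMatrix-rec p (suc q) ⟩
      a ^ p * (a * (d * d ^ q) + natR (suc p) * (b * det (arrowhead (suc q) c d)))
        ≈⟨ *-congˡ (+-congˡ (*-congˡ (*-congˡ (det-arrowhead (suc q) c d)))) ⟩
      a ^ p * (a * (d * d ^ q) + natR (suc p) * (b * - (natR (suc q) * (c * d ^ q))))
        ≈⟨ solve 8 (λ A D a b c d P Q → A :* (a :* (d :* D) :+ P :* (b :* :- (Q :* (c :* D))))
                                       := A :* D :* (a :* d :- P :* Q :* (b :* c))) refl
                 (a ^ p) (d ^ q) a b c d (natR (suc p)) (natR (suc q)) ⟩
      a ^ p * d ^ q * (a * d - natR (suc p) * natR (suc q) * (b * c)) ∎

-- The graph K₁ ∨ (K_p ⊔ K_q): vertex 0 is joined to everything, vertices 1 … p form one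
-- clique and p + 1 … p + q another.
coneOverCliques : ∀ p q → Fin (suc (p ℕ.+ q)) → Fin (suc (p ℕ.+ q)) → Bool
coneOverCliques p q zero    zero    = false
coneOverCliques p q zero    (suc j) = true
coneOverCliques p q (suc i) zero    = true
coneOverCliques p q (suc i) (suc j) =
  if (if toℕ i ℕ.<ᵇ p then toℕ j ℕ.<ᵇ p else not (toℕ j ℕ.<ᵇ p)) then not (does (i Fin.≟ j)) else false

coneOverCliques-sym : ∀ p q i j → coneOverCliques p q i j ≡ coneOverCliques p q j i
coneOverCliques-sym p q zero    zero    = ≡.refl
coneOverCliques-sym p q zero    (suc j) = ≡.refl
coneOverCliques-sym p q (suc i) zero    = ≡.refl
coneOverCliques-sym p q (suc i) (suc j)
  rewrite does-⇔ (mk⇔ ≡.sym ≡.sym) (i Fin.≟ j) (j Fin.≟ i)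
  with toℕ i ℕ.<ᵇ p | toℕ j ℕ.<ᵇ p
... | true  | true  = ≡.refl
... | true  | false = ≡.refl
... | false | true  = ≡.refl
... | false | false = ≡.refl

module Laplacian {r ℓ : Level} (R : CommutativeRing r ℓ) where
  open CommutativeRing R hiding (zero)
  open Matrices R
  open IntegerCoefficients R
  open Determinant R
  open BlockDeterminants R
  open import Algebra.Properties.Semiring.Sum semiring using (sum; sum-remove; ∑-distrib-+)
  open SetoidReasoning setoid

  indicator : Bool → Carrier
  indicator b = if b then 1# else 0#

  boolMatrix : ∀ {m} → (Fin m → Fin m → Bool) → Mat m
  boolMatrix A i j = indicator (A i j)

  charPolyAt-laplacian-cong : ∀ {m} (A B : Mat m) → (∀ i j → A i j ≈ B i j) → ∀ x →
                              charPolyAt (laplacian A) x ≈ charPolyAt (laplacian B) x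
  charPolyAt-laplacian-cong A B A≈B x = det-cong (λ i j → +-congˡ (-‿cong (+-cong (*-congˡ (degree≈ i)) (-‿cong (A≈B i j)))))
    where
    degree≈ : ∀ i → sumF (A i) ≈ sumF (B i)
    degree≈ i = ≡.subst₂ _≈_ (≡.sym (sumF≡sum (A i))) (≡.sym (sumF≡sum (B i))) (sum-cong (A i) (B i) (A≈B i))

  ∑-prefix : ∀ p q → sum {p ℕ.+ q} (λ j → indicator (toℕ j ℕ.<ᵇ p)) ≈ natR p
  ∑-prefix zero    q = sum-zero {q} (λ _ → 0#) (λ _ → refl)
  ∑-prefix (suc p) q = +-congˡ (∑-prefix p q)

  ∑-suffix : ∀ p q → sum {p ℕ.+ q} (λ j → indicator (not (toℕ j ℕ.<ᵇ p))) ≈ natR q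
  ∑-suffix zero    zero    = refl
  ∑-suffix zero    (suc q) = +-congˡ (∑-suffix zero q)
  ∑-suffix (suc p) q       = trans (+-identityˡ _) (∑-suffix p q)

  ∑-indicator-remove : ∀ {m} (B : Fin (suc m) → Bool) (i : Fin (suc m)) → B i ≡ true →
                       sum (λ j → indicator (B j)) ≈ 1# + sum (λ j → indicator (if B j then not (does (i Fin.≟ j)) else false))
  ∑-indicator-remove {m} B i Bi = begin
    sum (indicator ∘ B)                               ≈⟨ sum-remove {i = i} (indicator ∘ B) ⟩
    indicator (B i) + sum (indicator ∘ B ∘ punchIn i) ≈⟨ +-cong (reflexive (≡.cong indicator Bi)) (sum-cong _ _ (reflexive ∘ same)) ⟩
    1# + sum (B′ ∘ punchIn i)                         ≈⟨ +-congˡ (+-identityˡ _) ⟨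
    1# + (0# + sum (B′ ∘ punchIn i))                  ≈⟨ +-congˡ (+-congʳ (reflexive (≡.sym B′ᵢ))) ⟩
    1# + (B′ i + sum (B′ ∘ punchIn i))                ≈⟨ +-congˡ (sum-remove {i = i} B′) ⟨
    1# + sum B′                                       ∎
    where
    B′ : Fin (suc m) → Carrier
    B′ j = indicator (if B j then not (does (i Fin.≟ j)) else false)
    B′ᵢ : B′ i ≡ 0#
    B′ᵢ rewrite Bi | dec-true (i Fin.≟ i) ≡.refl = ≡.refl
    same : ∀ k → indicator (B (punchIn i k)) ≡ B′ (punchIn i k)
    same k rewrite dec-false (i Fin.≟ punchIn i k) (Fin.punchInᵢ≢i i k ∘ ≡.sym) with B (punchIn i k)
    ... | true  = ≡.refl
    ... | false = ≡.refl

  module _ (p q : ℕ) (x : Carrier) where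
    private
      P = suc p
      Q = suc q
      A : Mat (suc (P ℕ.+ Q))
      A = boolMatrix (coneOverCliques P Q)
      M : Mat (suc (P ℕ.+ Q))
      M i j = x * idM i j - laplacian A i j
      a d : Carrier
      a = x - natR (suc P)
      d = x - natR (suc Q)

      degree : ∀ i → sumF (A (suc i)) ≈ (if toℕ i ℕ.<ᵇ P then natR P else natR Q)
      degree i = trans (reflexive (sumF≡sum (A (suc i)))) (count i)
        where
        count : ∀ i → 1# + sum (λ j → indicator (if (if toℕ i ℕ.<ᵇ P then toℕ j ℕ.<ᵇ P else not (toℕ j ℕ.<ᵇ P))
                                                  then not (does (i Fin.≟ j)) else false))
                      ≈ (if toℕ i ℕ.<ᵇ P then natR P else natR Q)
        count i with toℕ i ℕ.<ᵇ P in i<P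
        ... | true  = trans (sym (∑-indicator-remove (λ j → toℕ j ℕ.<ᵇ P) i i<P)) (∑-prefix P Q)
        ... | false = trans (sym (∑-indicator-remove (λ j → not (toℕ j ℕ.<ᵇ P)) i (≡.cong not i<P))) (∑-suffix P Q)

      columnSum : ∀ j → sum (λ i → M i j) ≈ x
      columnSum j = begin
        sum (λ i → M i j)
          ≈⟨ sum-cong (λ i → M i j) (λ i → (x - sumF (A i)) * idM i j + A i j) (λ i →
               solve 4 (λ x δ D A → x :* δ :- (δ :* D :- A) := (x :- D) :* δ :+ A) refl x (idM i j) (sumF (A i)) (A i j)) ⟩
        sum (λ i → (x - sumF (A i)) * idM i j + A i j)
          ≈⟨ ∑-distrib-+ (λ i → (x - sumF (A i)) * idM i j) (λ i → A i j) ⟩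
        sum (λ i → (x - sumF (A i)) * idM i j) + sum (λ i → A i j)
          ≈⟨ +-cong (sum-single (λ i → (x - sumF (A i)) * idM i j) j (λ i i≢j →
                       trans (*-congˡ (reflexive (≡.cong indicator (dec-false (i Fin.≟ j) i≢j)))) (zeroʳ _)))
                    (sum-cong _ (A j) (λ i → reflexive (≡.cong indicator (coneOverCliques-sym P Q i j)))) ⟩
        (x - sumF (A j)) * idM j j + sum (A j)
          ≈⟨ +-cong (*-congˡ (reflexive (≡.cong indicator (dec-true (j Fin.≟ j) ≡.refl)))) (reflexive (≡.sym (sumF≡sum (A j)))) ⟩
        (x - sumF (A j)) * 1# + sumF (A j)
          ≈⟨ solve 2 (λ x D → (x :- D) :* con (+ 1) :+ D := x) refl x (sumF (A j)) ⟩
        x ∎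

      det-factorX : det M ≈ x * det (withRow₀ M (λ _ → 1#))
      det-factorX = begin
        det M
          ≈⟨ det-addCombinationToRow₀ (λ _ → 1#) M ⟨
        det (withRow₀ M (λ j → M zero j + sum (λ i → 1# * M (suc i) j)))
          ≈⟨ det-cong {M = withRow₀ M (λ j → M zero j + sum (λ i → 1# * M (suc i) j))} {N = withRow₀ M (λ _ → x)}
               (λ { zero j → trans (+-congˡ (sum-cong (λ i → 1# * M (suc i) j) (λ i → M (suc i) j) (λ i → *-identityˡ _)))
                                   (columnSum j)
                  ; (suc i) j → refl }) ⟩
        det (withRow₀ M (λ _ → x))
          ≈⟨ det-linear zero x _ (withRow₀ M (λ _ → 1#)) (withRow₀ M (λ _ → 0#))
               (λ j → sym (trans (+-identityʳ _) (*-identityʳ x))) others others ⟩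
        x * det (withRow₀ M (λ _ → 1#)) + det (withRow₀ M (λ _ → 0#))
          ≈⟨ +-congˡ (det-zeroRow zero (withRow₀ M (λ _ → 0#)) (λ j → refl)) ⟩
        x * det (withRow₀ M (λ _ → 1#)) + 0#
          ≈⟨ +-identityʳ _ ⟩
        x * det (withRow₀ M (λ _ → 1#)) ∎
        where
        others : ∀ {r r′} i → i ≢ zero → ∀ j → withRow₀ M r i j ≈ withRow₀ M r′ i j
        others zero    i≢0 j = ⊥-elim (i≢0 ≡.refl)
        others (suc i) _   j = refl

      diagonal : ∀ N D → D ≈ N → x * 1# - (1# * D - 0#) + - 1# * 1# ≈ x - (1# + N)
      diagonal N D D≈N = trans (+-congʳ (+-congˡ (-‿cong (+-congʳ (*-congˡ D≈N)))))
        (solve 2 (λ x N → x :* con (+ 1) :- (con (+ 1) :* N :- con (+ 0)) :+ con -[1+ 0 ] :* con (+ 1) := x :- (con (+ 1) :+ N)) refl x N)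

      entry : ∀ (δ bᵢ bⱼ : Bool) (D : Carrier) → D ≈ (if bᵢ then natR P else natR Q) →
              x * indicator δ - (indicator δ * D - indicator (if (if bᵢ then bⱼ else not bⱼ) then not δ else false)) + - 1# * 1#
              ≈ (if δ then (if bᵢ then a else d) else (if bᵢ then (if bⱼ then 0# else - 1#) else (if bⱼ then - 1# else 0#)))
      entry true  true  true  D D≈ = diagonal (natR P) D D≈
      entry true  true  false D D≈ = diagonal (natR P) D D≈
      entry true  false true  D D≈ = diagonal (natR Q) D D≈
      entry true  false false D D≈ = diagonal (natR Q) D D≈
      entry false true  true  D _ = solve 2 (λ x D → x :* con (+ 0) :- (con (+ 0) :* D :- con (+ 1)) :+ con -[1+ 0 ] :* con (+ 1) := con (+ 0)) refl x D
      entry false true  false D _ = solve 2 (λ x D → x :* con (+ 0) :- (con (+ 0) :* D :- con (+ 0)) :+ con -[1+ 0 ] :* con (+ 1) := con -[1+ 0 ]) refl x D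
      entry false false true  D _ = solve 2 (λ x D → x :* con (+ 0) :- (con (+ 0) :* D :- con (+ 0)) :+ con -[1+ 0 ] :* con (+ 1) := con -[1+ 0 ]) refl x D
      entry false false false D _ = solve 2 (λ x D → x :* con (+ 0) :- (con (+ 0) :* D :- con (+ 1)) :+ con -[1+ 0 ] :* con (+ 1) := con (+ 0)) refl x D

      det-reduceToBlocks : det (withRow₀ M (λ _ → 1#)) ≈ det (blockMatrix a (- 1#) (- 1#) d P Q)
      det-reduceToBlocks = begin
        det M₁
          ≈⟨ det-addMultiplesOfRow zero κ M₁ refl ⟨
        det (addMultiplesOfRow zero κ M₁)
          ≈⟨ det-blockTriangular (addMultiplesOfRow zero κ M₁)
               (λ i → solve 2 (λ x D → x :* con (+ 0) :- (con (+ 0) :* D :- con (+ 1)) :+ con -[1+ 0 ] :* con (+ 1) := con (+ 0)) refl x (sumF (A (suc i)))) ⟩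
        (1# + 0# * 1#) * det (λ i j → M (suc i) (suc j) + - 1# * 1#)
          ≈⟨ *-cong (solve 0 (con (+ 1) :+ con (+ 0) :* con (+ 1) := con (+ 1)) refl)
                    (det-cong {N = blockMatrix a (- 1#) (- 1#) d P Q}
                       (λ i j → entry (does (i Fin.≟ j)) (toℕ i ℕ.<ᵇ P) (toℕ j ℕ.<ᵇ P) (sumF (A (suc i))) (degree i))) ⟩
        1# * det (blockMatrix a (- 1#) (- 1#) d P Q)
          ≈⟨ *-identityˡ _ ⟩
        det (blockMatrix a (- 1#) (- 1#) d P Q) ∎
        where
        M₁ = withRow₀ M (λ _ → 1#)
        κ : Fin (suc (P ℕ.+ Q)) → Carrier
        κ zero    = 0#
        κ (suc i) = - 1#

    charPolyAt-coneOverCliques :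
      charPolyAt (laplacian (boolMatrix (coneOverCliques (suc p) (suc q)))) x
      ≈ x * (x - 1#) * (x - natR (suc (suc q))) ^ q * (x - natR (suc (suc p) ℕ.+ suc q)) * (x - natR (suc (suc p))) ^ p
    charPolyAt-coneOverCliques = begin
      det M
        ≈⟨ det-factorX ⟩
      x * det (withRow₀ M (λ _ → 1#))
        ≈⟨ *-congˡ det-reduceToBlocks ⟩
      x * det (blockMatrix a (- 1#) (- 1#) d P Q)
        ≈⟨ *-congˡ (det-blockMatrix a (- 1#) (- 1#) d p q) ⟩
      x * (a ^ p * d ^ q * (a * d - natR P * natR Q * (- 1# * - 1#)))
        ≈⟨ solve 5 (λ x P Q Aᵖ Dᵠ → x :* (Aᵖ :* Dᵠ :* ((x :- (con (+ 1) :+ P)) :* (x :- (con (+ 1) :+ Q)) :- P :* Q :* (con -[1+ 0 ] :* con -[1+ 0 ])))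
                                  := x :* (x :- con (+ 1)) :* Dᵠ :* (x :- (con (+ 1) :+ (P :+ Q))) :* Aᵖ) refl
                 x (natR P) (natR Q) (a ^ p) (d ^ q) ⟩
      x * (x - 1#) * d ^ q * (x - (1# + (natR P + natR Q))) * a ^ p
        ≈⟨ *-congʳ (*-congˡ (+-congˡ (-‿cong (+-congˡ (natR-+ P Q))))) ⟨
      x * (x - 1#) * d ^ q * (x - natR (suc P ℕ.+ Q)) * a ^ p ∎

splitAt-inj₁ : ∀ p {q} (i : Fin (p ℕ.+ q)) {r} → Fin.splitAt p i ≡ inj₁ r → (toℕ i ℕ.<ᵇ p) ≡ true
splitAt-inj₁ (suc p) zero    _ = ≡.refl
splitAt-inj₁ (suc p) (suc i) split with Fin.splitAt p i in splitᵢ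
splitAt-inj₁ (suc p) (suc i) ≡.refl | inj₁ _ = splitAt-inj₁ p i splitᵢ

splitAt-inj₂ : ∀ p {q} (i : Fin (p ℕ.+ q)) {f} → Fin.splitAt p i ≡ inj₂ f → (toℕ i ℕ.<ᵇ p) ≡ false
splitAt-inj₂ zero    i       _ = ≡.refl
splitAt-inj₂ (suc p) (suc i) split with Fin.splitAt p i in splitᵢ
splitAt-inj₂ (suc p) (suc i) ≡.refl | inj₂ _ = splitAt-inj₂ p i splitᵢ

splitAt-injective : ∀ p {q} (i j : Fin (p ℕ.+ q)) → Fin.splitAt p i ≡ Fin.splitAt p j → i ≡ j
splitAt-injective p {q} i j split≡ =
  ≡.trans (≡.sym (Fin.join-splitAt p q i)) (≡.trans (≡.cong (Fin.join p q) split≡) (Fin.join-splitAt p q j))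

-- h is the inverse of 2 modulo the odd number n = m + 2.
module DihedralCSEP (m h : ℕ) (h+h≡n+1 : h ℕ.+ h ≡ suc (suc (suc m))) where
  open +-*-Solver using (solve; _:+_; _:*_; _:=_; con)

  n : ℕ
  n = suc (suc m)

  infix  4 _≡ₙ_
  infixr 5 _∙ₙ_

  record _≡ₙ_ (a b : ℕ) : Set where
    constructor mod-n
    field %-≡ : a % n ≡ b % n

  _∙ₙ_ : ∀ {a b c} → a ≡ₙ b → b ≡ₙ c → a ≡ₙ c
  mod-n p ∙ₙ mod-n q = mod-n (≡.trans p q)

  ≡ₙ-sym : ∀ {a b} → a ≡ₙ b → b ≡ₙ a
  ≡ₙ-sym (mod-n p) = mod-n (≡.sym p)

  ≡⇒≡ₙ : ∀ {a b} → a ≡ b → a ≡ₙ b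
  ≡⇒≡ₙ a≡b = mod-n (≡.cong (_% n) a≡b)

  +-congₙ : ∀ {a a′ b b′} → a ≡ₙ a′ → b ≡ₙ b′ → a ℕ.+ b ≡ₙ a′ ℕ.+ b′
  +-congₙ {a} {a′} {b} {b′} (mod-n p) (mod-n q) = mod-n (begin
    (a ℕ.+ b) % n               ≡⟨ %-distribˡ-+ a b n ⟩
    (a % n ℕ.+ b % n) % n       ≡⟨ ≡.cong₂ (λ u v → (u ℕ.+ v) % n) p q ⟩
    (a′ % n ℕ.+ b′ % n) % n     ≡⟨ %-distribˡ-+ a′ b′ n ⟨
    (a′ ℕ.+ b′) % n             ∎)
    where open ≡.≡-Reasoning

  %ₙ : ∀ a → a % n ≡ₙ a
  %ₙ a = mod-n (m%n%n≡m%n a n)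

  +nₙ : ∀ a → a ℕ.+ n ≡ₙ a
  +nₙ a = mod-n ([m+n]%n≡m%n a n)

  +knₙ : ∀ a k → a ℕ.+ k ℕ.* n ≡ₙ a
  +knₙ a k = mod-n ([m+kn]%n≡m%n a k n)

  toℕ-injectiveₙ : ∀ {u v : Fin n} → toℕ u ≡ₙ toℕ v → u ≡ v
  toℕ-injectiveₙ {u} {v} (mod-n p) =
    Fin.toℕ-injective (≡.trans (≡.sym (m<n⇒m%n≡m (Fin.toℕ<n u))) (≡.trans p (m<n⇒m%n≡m (Fin.toℕ<n v))))

  toℕ-fromℕ<ₙ : ∀ a → toℕ (Fin.fromℕ< (m%n<n a n)) ≡ₙ a
  toℕ-fromℕ<ₙ a = ≡⇒≡ₙ (Fin.toℕ-fromℕ< _) ∙ₙ %ₙ a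

  toℕ-addMod : ∀ (i j : Fin n) → toℕ (addMod i j) ≡ₙ toℕ i ℕ.+ toℕ j
  toℕ-addMod i j = toℕ-fromℕ<ₙ _

  toℕ-negMod : ∀ (i : Fin n) → toℕ (negMod i) ≡ₙ n ∸ toℕ i
  toℕ-negMod i = toℕ-fromℕ<ₙ _

  i+[n∸i]≡n : ∀ (i : Fin n) → toℕ i ℕ.+ (n ∸ toℕ i) ≡ n
  i+[n∸i]≡n i = ℕ.m+[n∸m]≡n (ℕ.<⇒≤ (Fin.toℕ<n i))

  addMod-identityˡ : ∀ (i : Fin n) → addMod zero i ≡ i
  addMod-identityˡ i = toℕ-injectiveₙ (toℕ-addMod zero i)

  addMod-identityʳ : ∀ (i : Fin n) → addMod i zero ≡ i
  addMod-identityʳ i = toℕ-injectiveₙ (toℕ-addMod i zero ∙ₙ ≡⇒≡ₙ (ℕ.+-identityʳ _))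

  negMod-zero : negMod {n} zero ≡ zero
  negMod-zero = toℕ-injectiveₙ (toℕ-negMod zero ∙ₙ mod-n (n%n≡0 n))

  addMod-inverseʳ : ∀ (i : Fin n) → addMod i (negMod i) ≡ zero
  addMod-inverseʳ i = toℕ-injectiveₙ (toℕ-addMod i (negMod i) ∙ₙ +-congₙ (mod-n ≡.refl) (toℕ-negMod i)
                                       ∙ₙ ≡⇒≡ₙ (i+[n∸i]≡n i) ∙ₙ mod-n (n%n≡0 n))

  e : D n
  e = zero , false

  Conj-refl : ∀ (x : D n) → Conj x x
  Conj-refl (i , false) = e , ≡.cong (_, false) (≡.trans (≡.cong₂ addMod (addMod-identityˡ i) negMod-zero) (addMod-identityʳ i))
  Conj-refl (i , true)  = e , ≡.cong (_, true) (≡.trans (≡.cong₂ addMod (addMod-identityˡ i) negMod²-zero) (addMod-identityʳ i))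
    where
    negMod²-zero : negMod (negMod {n} zero) ≡ zero
    negMod²-zero = ≡.trans (≡.cong negMod negMod-zero) negMod-zero

  a : D n
  a = suc zero , false

  private
    aPower : ℕ → Fin n
    aPower p = Fin.fromℕ< (m%n<n (suc p) n)

    pow⁺-a : ∀ p → pow⁺ a p ≡ (aPower p , false)
    pow⁺-a zero    = ≡.cong (_, false) (toℕ-injectiveₙ (≡ₙ-sym (toℕ-fromℕ<ₙ 1)))
    pow⁺-a (suc p) rewrite pow⁺-a p = ≡.cong (_, false) (toℕ-injectiveₙ
      (toℕ-addMod (suc zero) (aPower p) ∙ₙ +-congₙ {a = 1} {a′ = 1} (mod-n ≡.refl) (toℕ-fromℕ<ₙ (suc p)) ∙ₙ ≡ₙ-sym (toℕ-fromℕ<ₙ (suc (suc p)))))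

  rotation-∈⟨a⟩ : ∀ (r : Fin n) → ∃[ p ] (r , false) ≡ pow⁺ a p
  rotation-∈⟨a⟩ r = toℕ r ℕ.+ suc m , ≡.trans (≡.cong (_, false) (toℕ-injectiveₙ r≡)) (≡.sym (pow⁺-a _))
    where
    r≡ : toℕ r ≡ₙ toℕ (aPower (toℕ r ℕ.+ suc m))
    r≡ = ≡ₙ-sym (toℕ-fromℕ<ₙ _ ∙ₙ ≡⇒≡ₙ (≡.sym (ℕ.+-suc (toℕ r) (suc m))) ∙ₙ +nₙ (toℕ r))

  pow⁺-rotation : ∀ (w : Fin n) p → proj₂ (pow⁺ (w , false) p) ≡ false
  pow⁺-rotation w zero    = ≡.refl
  pow⁺-rotation w (suc p) = pow⁺-rotation w p

  pow⁺-reflection : ∀ (w : Fin n) p → pow⁺ (w , true) p ≡ (w , true) ⊎ pow⁺ (w , true) p ≡ e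
  pow⁺-reflection w zero = inj₁ ≡.refl
  pow⁺-reflection w (suc p) with pow⁺-reflection w p
  ... | inj₁ wᵖ≡w rewrite wᵖ≡w | addMod-inverseʳ w = inj₂ ≡.refl
  ... | inj₂ wᵖ≡e rewrite wᵖ≡e | negMod-zero | addMod-identityʳ w = inj₁ ≡.refl

  -- Conjugating (f , true) by (w , true) gives (2w − f , true), and 2w − f = f′ for w = (f + f′) h.
  reflections-conjugate : ∀ (f f′ : Fin n) → Conj (f , true) (f′ , true)
  reflections-conjugate f f′ = (w , true) , ≡.cong (_, true) (toℕ-injectiveₙ 2w-f≡f′)
    where
    W = (toℕ f ℕ.+ toℕ f′) ℕ.* h
    w : Fin n
    w = Fin.fromℕ< (m%n<n W n)
    g = n ∸ toℕ f
    distrib₁ : ∀ a b H G → (a ℕ.+ b) ℕ.* H ℕ.+ G ℕ.+ (a ℕ.+ b) ℕ.* H ≡ (a ℕ.+ b) ℕ.* (H ℕ.+ H) ℕ.+ G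
    distrib₁ = solve 4 (λ a b H G → (a :+ b) :* H :+ G :+ (a :+ b) :* H := (a :+ b) :* (H :+ H) :+ G) ≡.refl
    distrib₂ : ∀ a b N G → (a ℕ.+ b) ℕ.* suc N ℕ.+ G ≡ (b ℕ.+ (a ℕ.+ G)) ℕ.+ (a ℕ.+ b) ℕ.* N
    distrib₂ = solve 4 (λ a b N G → (a :+ b) :* (con 1 :+ N) :+ G := (b :+ (a :+ G)) :+ (a :+ b) :* N) ≡.refl
    2w-f≡f′ : toℕ (addMod (addMod w (negMod f)) w) ≡ₙ toℕ f′
    2w-f≡f′ = toℕ-addMod _ w ∙ₙ +-congₙ (toℕ-addMod w (negMod f) ∙ₙ +-congₙ (toℕ-fromℕ<ₙ W) (toℕ-negMod f)) (toℕ-fromℕ<ₙ W)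
            ∙ₙ ≡⇒≡ₙ (≡.trans (distrib₁ (toℕ f) (toℕ f′) h g) (≡.cong (λ H → (toℕ f ℕ.+ toℕ f′) ℕ.* H ℕ.+ g) h+h≡n+1))
            ∙ₙ ≡⇒≡ₙ (distrib₂ (toℕ f) (toℕ f′) n g)
            ∙ₙ +knₙ _ (toℕ f ℕ.+ toℕ f′)
            ∙ₙ ≡⇒≡ₙ (≡.cong (toℕ f′ ℕ.+_) (i+[n∸i]≡n f))
            ∙ₙ +nₙ (toℕ f′)

  Conj-rotation : ∀ (r : Fin n) (y : D n) → Conj (r , false) y → proj₂ y ≡ false × (proj₁ y ≡ zero → r ≡ zero)
  Conj-rotation r y ((w , false) , ≡.refl) = ≡.refl , λ y≡0 → ≡.sym (toℕ-injectiveₙ (≡ₙ-sym (≡⇒≡ₙ (≡.cong toℕ y≡0)) ∙ₙ w+r-w≡r))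
    where
    w+r-w≡r : toℕ (addMod (addMod w r) (negMod w)) ≡ₙ toℕ r
    w+r-w≡r = toℕ-addMod (addMod w r) (negMod w) ∙ₙ +-congₙ (toℕ-addMod w r) (toℕ-negMod w)
            ∙ₙ ≡⇒≡ₙ (≡.trans (solve 3 (λ W R G → W :+ R :+ G := R :+ (W :+ G)) ≡.refl (toℕ w) (toℕ r) (n ∸ toℕ w))
                              (≡.cong (toℕ r ℕ.+_) (i+[n∸i]≡n w)))
            ∙ₙ +nₙ (toℕ r)
  Conj-rotation r y ((w , true) , ≡.refl) = ≡.refl , λ y≡0 → negMod-zero⇒zero r (≡ₙ-sym (≡⇒≡ₙ (≡.cong toℕ y≡0)) ∙ₙ w-r-w≡-r)
    where
    w-r-w≡-r : toℕ (addMod (addMod w (negMod r)) (negMod w)) ≡ₙ n ∸ toℕ r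
    w-r-w≡-r = toℕ-addMod _ (negMod w) ∙ₙ +-congₙ (toℕ-addMod w (negMod r) ∙ₙ +-congₙ (mod-n ≡.refl) (toℕ-negMod r)) (toℕ-negMod w)
             ∙ₙ ≡⇒≡ₙ (≡.trans (solve 3 (λ W R G → W :+ R :+ G := R :+ (W :+ G)) ≡.refl (toℕ w) (n ∸ toℕ r) (n ∸ toℕ w))
                               (≡.cong ((n ∸ toℕ r) ℕ.+_) (i+[n∸i]≡n w)))
             ∙ₙ +nₙ (n ∸ toℕ r)
    negMod-zero⇒zero : ∀ (r : Fin n) → 0 ≡ₙ n ∸ toℕ r → r ≡ zero
    negMod-zero⇒zero zero    _           = ≡.refl
    negMod-zero⇒zero (suc r) (mod-n 0≡-r) = ⊥-elim (ℕ.<⇒≢ (ℕ.m<n⇒0<n∸m (Fin.toℕ<n (suc r)))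
      (≡.trans 0≡-r (m<n⇒m%n≡m (ℕ.∸-monoʳ-< (ℕ.s≤s ℕ.z≤n) (ℕ.<⇒≤ (Fin.toℕ<n (suc r)))))))

  Conj-reflection : ∀ (f : Fin n) (y : D n) → Conj (f , true) y → proj₂ y ≡ true
  Conj-reflection f y ((w , false) , ≡.refl) = ≡.refl
  Conj-reflection f y ((w , true)  , ≡.refl) = ≡.refl

  -- Every power of a reflection is itself or e, and every power of a rotation is a rotation.
  rotation-reflection-notCyclic : ∀ (x′ y′ z : D n) p q → proj₂ x′ ≡ false → proj₁ x′ ≢ zero → proj₂ y′ ≡ true →
                                  x′ ≡ pow⁺ z p → y′ ≡ pow⁺ z q → ⊥
  rotation-reflection-notCyclic x′ y′ (w , false) p q _ _ y′-refl _ y′≡ with ≡.trans (≡.sym y′-refl) (≡.trans (≡.cong proj₂ y′≡) (pow⁺-rotation w q))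
  ... | ()
  rotation-reflection-notCyclic x′ y′ (w , true) p q x′-rot x′≢e _ x′≡ _ with pow⁺-reflection w p
  ... | inj₁ wᵖ≡w with ≡.trans (≡.sym x′-rot) (≡.cong proj₂ (≡.trans x′≡ wᵖ≡w))
  ...   | ()
  rotation-reflection-notCyclic x′ y′ (w , true) p q x′-rot x′≢e _ x′≡ _ | inj₂ wᵖ≡e = x′≢e (≡.cong proj₁ (≡.trans x′≡ wᵖ≡e))

  isZero : Fin n → Bool
  isZero zero    = true
  isZero (suc _) = false

  adjacency : D n → D n → Bool
  adjacency (r , false) (r′ , false) = not (does (r Fin.≟ r′))
  adjacency (r , false) (f , true)   = isZero r
  adjacency (f , true)  (r , false)  = isZero r
  adjacency (f , true)  (f′ , true)  = not (does (f Fin.≟ f′))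

  CSEPAdj⇒adjacency : ∀ u v → CSEPAdj u v → adjacency u v ≡ true
  CSEPAdj⇒adjacency (r , false) (r′ , false) (u≢v , _) with r Fin.≟ r′
  ... | yes ≡.refl = ⊥-elim (u≢v ≡.refl)
  ... | no  _      = ≡.refl
  CSEPAdj⇒adjacency (f , true) (f′ , true) (u≢v , _) with f Fin.≟ f′
  ... | yes ≡.refl = ⊥-elim (u≢v ≡.refl)
  ... | no  _      = ≡.refl
  CSEPAdj⇒adjacency (zero , false) (f , true) _ = ≡.refl
  CSEPAdj⇒adjacency (suc r , false) (f , true) (_ , x′ , y′ , x~x′ , y~y′ , z , p , q , x′≡ , y′≡) =
    ⊥-elim (rotation-reflection-notCyclic x′ y′ z p q (proj₁ (Conj-rotation (suc r) x′ x~x′))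
              (λ x′≡0 → Fin.0≢1+n (≡.sym (proj₂ (Conj-rotation (suc r) x′ x~x′) x′≡0))) (Conj-reflection f y′ y~y′) x′≡ y′≡)
  CSEPAdj⇒adjacency (f , true) (zero , false) _ = ≡.refl
  CSEPAdj⇒adjacency (f , true) (suc r , false) (_ , x′ , y′ , x~x′ , y~y′ , z , p , q , x′≡ , y′≡) =
    ⊥-elim (rotation-reflection-notCyclic y′ x′ z q p (proj₁ (Conj-rotation (suc r) y′ y~y′))
              (λ y′≡0 → Fin.0≢1+n (≡.sym (proj₂ (Conj-rotation (suc r) y′ y~y′) y′≡0))) (Conj-reflection f x′ x~x′) y′≡ x′≡)

  adjacency⇒CSEPAdj : ∀ u v → adjacency u v ≡ true → CSEPAdj u v
  adjacency⇒CSEPAdj (r , false) (r′ , false) adj with r Fin.≟ r′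
  adjacency⇒CSEPAdj (r , false) (r′ , false) () | yes _
  ... | no r≢r′ = (r≢r′ ∘ ≡.cong proj₁) , _ , _ , Conj-refl _ , Conj-refl _ , a ,
                  proj₁ (rotation-∈⟨a⟩ r) , proj₁ (rotation-∈⟨a⟩ r′) , proj₂ (rotation-∈⟨a⟩ r) , proj₂ (rotation-∈⟨a⟩ r′)
  adjacency⇒CSEPAdj (zero , false) (f , true) _ =
    (λ ()) , _ , _ , Conj-refl _ , Conj-refl _ , (f , true) , 1 , 0 , ≡.cong (_, false) (≡.sym (addMod-inverseʳ f)) , ≡.refl
  adjacency⇒CSEPAdj (f , true) (zero , false) _ =
    (λ ()) , _ , _ , Conj-refl _ , Conj-refl _ , (f , true) , 0 , 1 , ≡.refl , ≡.cong (_, false) (≡.sym (addMod-inverseʳ f))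
  adjacency⇒CSEPAdj (f , true) (f′ , true) adj with f Fin.≟ f′
  adjacency⇒CSEPAdj (f , true) (f′ , true) () | yes _
  ... | no f≢f′ = (f≢f′ ∘ ≡.cong proj₁) , (f′ , true) , (f′ , true) , reflections-conjugate f f′ , Conj-refl _ ,
                  (f′ , true) , 0 , 0 , ≡.refl , ≡.refl

  does-CSEPAdj : (adj? : (u v : D n) → Dec (CSEPAdj u v)) → ∀ u v → does (adj? u v) ≡ adjacency u v
  does-CSEPAdj adj? u v with adj? u v | adjacency u v in adj
  ... | yes uv | _     = ≡.trans (≡.sym (CSEPAdj⇒adjacency u v uv)) adj
  ... | no ¬uv | true  = ⊥-elim (¬uv (adjacency⇒CSEPAdj u v adj))
  ... | no _   | false = ≡.refl

  adjacency-vertex : ∀ i j → adjacency (vertex n i) (vertex n j) ≡ coneOverCliques (suc m) n i j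
  adjacency-vertex zero zero = ≡.refl
  adjacency-vertex zero (suc j) with Fin.splitAt (suc m) j
  ... | inj₁ _ = ≡.refl
  ... | inj₂ _ = ≡.refl
  adjacency-vertex (suc i) zero with Fin.splitAt (suc m) i
  ... | inj₁ _ = ≡.refl
  ... | inj₂ _ = ≡.refl
  adjacency-vertex (suc i) (suc j) with Fin.splitAt (suc m) i in splitᵢ | Fin.splitAt (suc m) j in splitⱼ
  ... | inj₁ r | inj₁ r′ rewrite splitAt-inj₁ (suc m) i splitᵢ | splitAt-inj₁ (suc m) j splitⱼ =
    ≡.cong not (does-⇔ (mk⇔ (λ { ≡.refl → splitAt-injective (suc m) i j (≡.trans splitᵢ (≡.sym splitⱼ)) })
                            (λ { ≡.refl → Sum.inj₁-injective (≡.trans (≡.sym splitᵢ) splitⱼ) }))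
                       (r Fin.≟ r′) (i Fin.≟ j))
  ... | inj₂ f | inj₂ f′ rewrite splitAt-inj₂ (suc m) i splitᵢ | splitAt-inj₂ (suc m) j splitⱼ =
    ≡.cong not (does-⇔ (mk⇔ (λ { ≡.refl → splitAt-injective (suc m) i j (≡.trans splitᵢ (≡.sym splitⱼ)) })
                            (λ { ≡.refl → Sum.inj₂-injective (≡.trans (≡.sym splitᵢ) splitⱼ) }))
                       (f Fin.≟ f′) (i Fin.≟ j))
  ... | inj₁ _ | inj₂ _ rewrite splitAt-inj₁ (suc m) i splitᵢ | splitAt-inj₂ (suc m) j splitⱼ = ≡.refl
  ... | inj₂ _ | inj₁ _ rewrite splitAt-inj₂ (suc m) i splitᵢ | splitAt-inj₁ (suc m) j splitⱼ = ≡.refl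

[1+n/2]*2≡1+n : ∀ n → n % 2 ≡ 1 → suc (n / 2) ℕ.+ suc (n / 2) ≡ suc n
[1+n/2]*2≡1+n n n-odd = begin
  suc (n / 2) ℕ.+ suc (n / 2)    ≡⟨ solve 1 (λ h → (con 1 :+ h) :+ (con 1 :+ h) := con 1 :+ (con 1 :+ h :* con 2)) ≡.refl (n / 2) ⟩
  suc (1 ℕ.+ n / 2 ℕ.* 2)        ≡⟨ ≡.cong (λ r → suc (r ℕ.+ n / 2 ℕ.* 2)) n-odd ⟨
  suc (n % 2 ℕ.+ n / 2 ℕ.* 2)    ≡⟨ ≡.cong suc (m≡m%n+[m/n]*n n 2) ⟨
  suc n                          ∎
  where
  open ≡.≡-Reasoning
  open +-*-Solver using (solve; _:+_; _:*_; _:=_; con)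

mainTheorem2 : ∀ {c ℓ : Level} (R : CommutativeRing c ℓ) (n : ℕ) → 3 ≤ n → n % 2 ≡ 1 →
    (adj? : (u v : D n) → Dec (CSEPAdj u v)) → (x : CommutativeRing.Carrier R) →
    let open CommutativeRing R
        open Matrices R
    in charPolyAt (laplacian (adjMatrix (vertex n) CSEPAdj adj?)) x
       ≈ x * (x - 1#) * ((x - natR (n Data.Nat.+ 1)) ^ (n ∸ 1)) * (x - natR (2 Data.Nat.* n))
         * ((x - natR n) ^ (n ∸ 2))
mainTheorem2 R n@(suc (suc (suc k))) (ℕ.s≤s (ℕ.s≤s (ℕ.s≤s _))) n-odd adj? x = begin
  charPolyAt (laplacian (adjMatrix (vertex n) CSEPAdj adj?)) x
    ≈⟨ charPolyAt-laplacian-cong (adjMatrix (vertex n) CSEPAdj adj?) (boolMatrix (coneOverCliques (suc (suc k)) n))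
         (λ i j → reflexive (≡.cong indicator (≡.trans (does-CSEPAdj adj? (vertex n i) (vertex n j)) (adjacency-vertex i j)))) x ⟩
  charPolyAt (laplacian (boolMatrix (coneOverCliques (suc (suc k)) n))) x
    ≈⟨ charPolyAt-coneOverCliques (suc k) (suc (suc k)) x ⟩
  x * (x - 1#) * (x - natR (suc n)) ^ (n ∸ 1) * (x - natR (n ℕ.+ n)) * (x - natR n) ^ (n ∸ 2)
    ≡⟨ ≡.cong₂ (λ u v → x * (x - 1#) * (x - natR u) ^ (n ∸ 1) * (x - natR v) * (x - natR n) ^ (n ∸ 2))
               (ℕ.+-comm 1 n) (≡.cong (n ℕ.+_) (≡.sym (ℕ.+-identityʳ n))) ⟩
  x * (x - 1#) * (x - natR (n ℕ.+ 1)) ^ (n ∸ 1) * (x - natR (2 ℕ.* n)) * (x - natR n) ^ (n ∸ 2) ∎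
  where
  open CommutativeRing R
  open Matrices R
  open Laplacian R
  open DihedralCSEP (suc k) (suc (n / 2)) ([1+n/2]*2≡1+n n n-odd) hiding (n)
  open SetoidReasoning setoid
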